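{- Let $\phi$ be an instance of \textsc{Max (2,3)-SAT} with $n$ variables, let $\mathsf{opt}_A(\phi)$ be the maximum number of clauses of $\phi$ satisfiable by an assignment, and let $\mathsf{opt}_B(T_\phi)$ be the maximum tournament value over all seedings of the \textsc{Tournament Value Maximization} instance $T_\phi$ constructed from $\phi$ as described in the context. Then $\mathsf{opt}_B(T_\phi)=\mathsf{opt}_A(\phi)+n$.
   Context: Tournament model: players are natural numbers forming a set $N$ with $|N|=2^{n'}$; player $i$ beats $j$ iff $i>j$. A seeding is a bijection $\sigma:N\to\{1,\dots,|N|\}$. In round $r=1,\dots,n'$, for each block of $2^r$ consecutive seed positions $\{(t-1)2^r+1,\dots,t2^r\}$, the winner $i_1$ of the first half (its strongest player) plays the winner $i_2$ of the second half with game value $v(i_1,i_2,r)$; the block winner is $\max(i_1,i_2)$. The tournament value is the sum of all game values. \textsc{Max (2,3)-SAT}: a Boolean formula $\phi$ in which each clause has exactly two literals and each variable appears in at most three clauses. For each variable $x$, fix an order of its appearances in clauses (1st, 2nd, 3rd appearance). Construction of $T_\phi$ from $\phi$ with variables $x_1,\dots,x_n$ and clauses $c_1,\dots,c_m$: for each variable $x$ create players $x,x^T,x^F$; for each clause $c$ a player $c$; let $n'$ be smallest with $16n\le 2^{n'}$, $p=2^{n'}-16n$, and create dummy players $f_1,\dots,f_{13n+p-m}$. Strength order: $x_1>x_1^T>x_1^F>x_2>\dots>x_n>x_n^T>x_n^F>c_1>\dots>c_m>f_1>\dots>f_{13n+p-m}$. The game-value function is symmetric ($v(a,b,r)=v(b,a,r)$)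 with: $v(x,x^T,1)=v(x,x^F,1)=1$ for each variable $x$; if the $j$th appearance of $x$ is in clause $c$, then $v(c,x^T,j)=1$ if $x$ appears non-negated in $c$ and $v(c,x^F,j)=1$ if negated; all other values for rounds $1,\dots,n'$ are $0$. -}

module Defs where

open import Data.Nat using (ℕ; zero; suc; _+_; _*_; _∸_; _^_; _≤_; _<_; _⊔_; _≡ᵇ_)
open import Data.Nat.Properties using (_<?_)
open import Data.Bool using (Bool; true; false; _∧_; _∨_; not; if_then_else_; T)
open import Data.Fin using (Fin; toℕ; fromℕ<) renaming (_≟_ to _≟ᶠ_)
open import Data.Fin.Permutation using (Permutation′; _⟨$⟩ˡ_)
open import Data.List using (List; map; allFin)
open import Data.Nat.ListAction using (sum)
open import Data.Bool.ListAction using (any)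
open import Data.Product using (_×_; _,_; proj₁; proj₂; ∃)
open import Relation.Nullary using (yes; no; does)
open import Relation.Binary.PropositionalEquality using (_≡_)

-- A literal over n variables: (variable, sign); sign true = non-negated.
Literal : ℕ → Set
Literal n = Fin n × Bool

Clause : ℕ → Set
Clause n = Literal n × Literal n

record Formula : Set where
  field
    nVars    : ℕ
    nClauses : ℕ
    clause   : Fin nClauses → Clause nVars
open Formula public

module _ (φ : Formula) where
  occursB : Fin (nVars φ) → Fin (nClauses φ) → Bool
  occursB x c = does (proj₁ (proj₁ (clause φ c)) ≟ᶠ x) ∨ does (proj₁ (proj₂ (clause φ c)) ≟ᶠ x)

  posB : Fin (nVars φ) → Fin (nClauses φ) → Bool
  posB x c = (does (proj₁ (proj₁ (clause φ c)) ≟ᶠ x) ∧ proj₂ (proj₁ (clause φ c)))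
           ∨ (does (proj₁ (proj₂ (clause φ c)) ≟ᶠ x) ∧ proj₂ (proj₂ (clause φ c)))

  negB : Fin (nVars φ) → Fin (nClauses φ) → Bool
  negB x c = (does (proj₁ (proj₁ (clause φ c)) ≟ᶠ x) ∧ not (proj₂ (proj₁ (clause φ c))))
           ∨ (does (proj₁ (proj₂ (clause φ c)) ≟ᶠ x) ∧ not (proj₂ (proj₂ (clause φ c))))

  occurrences : Fin (nVars φ) → ℕ
  occurrences x = sum (map (λ c → if occursB x c then 1 else 0) (allFin (nClauses φ)))

  Is23 : Set
  Is23 = ∀ x → occurrences x ≤ 3

  Assignment : Set
  Assignment = Fin (nVars φ) → Bool

  litVal : Assignment → Literal (nVars φ) → Bool
  litVal a (x , s) = if s then a x else not (a x)

  numSat : Assignment → ℕ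
  numSat a = sum (map (λ c → if litVal a (proj₁ (clause φ c)) ∨ litVal a (proj₂ (clause φ c)) then 1 else 0)
                      (allFin (nClauses φ)))

  IsOptA : ℕ → Set
  IsOptA k = (∃ λ a → numSat a ≡ k) × (∀ a → numSat a ≤ k)

  -- An order of appearances: ord x c (when x appears in c) is the index
  -- (0-based: 0,1,2 for 1st,2nd,3rd) of the appearance of x in clause c.
  AppOrder : Set
  AppOrder = Fin (nVars φ) → Fin (nClauses φ) → Fin 3

  -- ord enumerates the appearances of each variable as 1st, 2nd, ..., kth:
  -- injective on the clauses containing x, with image an initial segment.
  ValidOrder : AppOrder → Set
  ValidOrder ord =
    (∀ x c c' → T (occursB x c) → T (occursB x c') → ord x c ≡ ord x c' → c ≡ c')
    × (∀ x c → T (occursB x c) → ∀ (j : Fin 3) → toℕ j < toℕ (ord x c)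
         → ∃ λ c' → T (occursB x c') × ord x c' ≡ j)

-- Tournaments. Players are the natural numbers 0 .. 2^r - 1; i beats j iff i > j.
-- Seed positions are 0-based: 0 .. 2^r - 1.

-- run v s k off: the sub-tournament on seed positions off .. off + 2^k - 1,
-- where s p is the player seeded at position p. Returns (winner, sum of game values).
run : (ℕ → ℕ → ℕ → ℕ) → (ℕ → ℕ) → ℕ → ℕ → ℕ × ℕ
run v s zero off = s off , 0
run v s (suc k) off =
  let l = run v s k off
      r = run v s k (off + 2 ^ k)
  in (proj₁ l ⊔ proj₁ r) , (proj₂ l + proj₂ r + v (proj₁ l) (proj₁ r) (suc k))

-- the player at seed position p under seeding σ (σ maps players to positions)
seat : (N : ℕ) → Permutation′ N → ℕ → ℕ
seat N σ p with p <? N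
... | yes h = toℕ (σ ⟨$⟩ˡ fromℕ< h)
... | no _  = 0

tvalue : (r : ℕ) → (ℕ → ℕ → ℕ → ℕ) → Permutation′ (2 ^ r) → ℕ
tvalue r v σ = proj₂ (run v (seat (2 ^ r) σ) r 0)

IsOptB : (r : ℕ) → (ℕ → ℕ → ℕ → ℕ) → ℕ → Set
IsOptB r v k = (∃ λ σ → tvalue r v σ ≡ k) × (∀ σ → tvalue r v σ ≤ k)

IsLeastExp : ℕ → ℕ → Set
IsLeastExp n r = (16 * n ≤ 2 ^ r) × (∀ j → 16 * n ≤ 2 ^ j → r ≤ j)

module Construction (φ : Formula) (ord : AppOrder φ) (r : ℕ) where
  N : ℕ
  N = 2 ^ r

  -- player numbers: x_1 > x_1^T > x_1^F > x_2 > ... > x_n^F > c_1 > ... > c_m > dummies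
  X XT XF : Fin (nVars φ) → ℕ
  X  i = N ∸ 1 ∸ 3 * toℕ i
  XT i = N ∸ 2 ∸ 3 * toℕ i
  XF i = N ∸ 3 ∸ 3 * toℕ i

  C : Fin (nClauses φ) → ℕ
  C c = N ∸ 1 ∸ 3 * nVars φ ∸ toℕ c
  -- the remaining players 0 .. N - 1 - 3n - m are the dummies f_{13n+p-m} < ... < f_1

  -- directed part of the value-1 relation
  gvB : ℕ → ℕ → ℕ → Bool
  gvB a b rd =
    any (λ i → (a ≡ᵇ X i) ∧ ((b ≡ᵇ XT i) ∨ (b ≡ᵇ XF i)) ∧ (rd ≡ᵇ 1)) (allFin (nVars φ))
    ∨ any (λ c → any (λ x → (a ≡ᵇ C c) ∧ occursB φ x c ∧ (rd ≡ᵇ suc (toℕ (ord x c)))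
                              ∧ ((posB φ x c ∧ (b ≡ᵇ XT x)) ∨ (negB φ x c ∧ (b ≡ᵇ XF x))))
                     (allFin (nVars φ)))
          (allFin (nClauses φ))

  gameValue : ℕ → ℕ → ℕ → ℕ
  gameValue a b rd = if gvB a b rd ∨ gvB b a rd then 1 else 0

{-# OPTIONS --safe #-}
-- Every player but the champion loses exactly one game, so the value of a seeding is the sum,
-- over players, of the value of the game they lost. A game has value 1 only if x^T or x^F loses to x
-- in round 1, or a clause c loses to x^T (x^F) in the round of its appearance in which x occurs
-- positively (negatively). As x plays a single first-round game, at most one of its literals loses
-- there, and that literal plays no later round, so it eliminates no clause. Hence variable x
-- contributes at most 1 plus the number of clauses eliminated by one of its literals (x occurs in at
-- most three clauses); making that literal true satisfies all those clauses, and each clause is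
-- eliminated only once, so every seeding is worth at most n + opt_A. Conversely, for an optimal
-- assignment seat each x beside its false literal, and its true literal in a block of eight seats
-- where it meets, in rounds 1, 2 and 3, the satisfied clauses assigned to it, padded with dummies.

module Submission where

open import Defs
open import Data.Nat using (ℕ; zero; suc; _+_; _*_; _∸_; _^_; _≤_; _<_; _⊔_; _⊓_; _≡ᵇ_; _≤ᵇ_; z≤n; s≤s)
open import Data.Nat.Properties
import Data.Nat.ListAction as List
open import Data.Bool using (Bool; true; false; _∧_; _∨_; not; if_then_else_; T)
open import Data.Bool.Properties using (∨-comm; T-∧; T-∨; T-≡)
open import Data.Fin using (Fin; toℕ; fromℕ<; combine; remQuot; _↑ʳ_) renaming (suc to fsuc; _≟_ to _≟ᶠ_)
import Data.Fin.Properties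
open Data.Fin.Properties using () renaming (suc-injective to fsuc-injective)
open Data.Fin.Properties using (toℕ-injective; toℕ<n; toℕ-fromℕ<; remQuot-combine; combine-remQuot; combine-injective; toℕ-combine; fromℕ<-injective; any?)
open import Data.Fin.Patterns using (0F; 1F; 2F; 3F; 4F; 5F; 6F; 7F; 8F; 9F)
open import Data.Fin.Permutation using (Permutation′; _⟨$⟩ˡ_; _⟨$⟩ʳ_; inverseˡ; inverseʳ; transpose; flip; _∘ₚ_)
import Data.Fin.Permutation as Perm
import Data.Fin.Permutation.Components as PC
open import Data.List using (map; allFin; tabulate)
open import Data.List.Properties using (map-tabulate)
open import Data.List.Relation.Unary.Any using (satisfied)
open import Data.List.Relation.Unary.Any.Properties using (any⁺; any⁻)
open import Data.List.Membership.Propositional using (lose)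
open import Data.List.Membership.Propositional.Properties using (∈-allFin)
open import Data.Bool.ListAction using (any)
open import Data.Maybe using (Maybe; just; nothing; _<∣>_)
import Data.Maybe.Properties
open Data.Maybe.Properties using (just-injective)
open import Data.Product using (_×_; _,_; proj₁; proj₂; ∃; Σ-syntax; uncurry)
import Data.Product.Properties
open Data.Product.Properties using (,-injective)
open import Data.Sum using (_⊎_; inj₁; inj₂; [_,_]′)
open import Data.Empty using (⊥; ⊥-elim)
open import Function using (_∘_; id; Equivalence; Injective)
open import Relation.Nullary using (Dec; yes; no; does)
open import Relation.Nullary.Decidable using (T?; dec-true; dec-false)
open import Relation.Binary.Definitions using (DecidableEquality)
open import Relation.Binary.PropositionalEquality
open import Algebra.Properties.CommutativeMonoid.Sum +-0-commutativeMonoid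
  using (sum-syntax; ∑-distrib-+; ∑-comm)

T-∧⁻ : ∀ {x y} → T (x ∧ y) → T x × T y
T-∧⁻ = Equivalence.to T-∧

T-∧⁺ : ∀ {x y} → T x → T y → T (x ∧ y)
T-∧⁺ p q = Equivalence.from T-∧ (p , q)

T-∨⁻ : ∀ {x y} → T (x ∨ y) → T x ⊎ T y
T-∨⁻ = Equivalence.to T-∨

T-∨⁺ˡ : ∀ {x y} → T x → T (x ∨ y)
T-∨⁺ˡ p = Equivalence.from T-∨ (inj₁ p)

T-∨⁺ʳ : ∀ {x y} → T y → T (x ∨ y)
T-∨⁺ʳ q = Equivalence.from T-∨ (inj₂ q)

T-any-allFin⁻ : ∀ {k} (f : Fin k → Bool) → T (any f (allFin k)) → ∃ λ i → T (f i)
T-any-allFin⁻ {k} f h = satisfied (any⁻ f (allFin k) h)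

T-any-allFin⁺ : ∀ {k} (f : Fin k → Bool) i → T (f i) → T (any f (allFin k))
T-any-allFin⁺ f i h = any⁺ f (lose (∈-allFin i) h)

does⇒ : ∀ {A : Set} (d : Dec A) → T (does d) → A
does⇒ (yes a) _ = a

does⇐ : ∀ {A : Set} (d : Dec A) → A → T (does d)
does⇐ (yes _)  _ = _
does⇐ (no ¬a) a = ¬a a

T-from-≡ : ∀ {b} → b ≡ true → T b
T-from-≡ = Equivalence.from T-≡

≡ᵇ-refl : ∀ n → (n ≡ᵇ n) ≡ true
≡ᵇ-refl zero    = refl
≡ᵇ-refl (suc n) = ≡ᵇ-refl n

≡ᵇ-≢ : ∀ m n → m ≢ n → (m ≡ᵇ n) ≡ false
≡ᵇ-≢ m n m≢n with m ≡ᵇ n in eq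
... | false = refl
... | true  = ⊥-elim (m≢n (≡ᵇ⇒≡ m n (T-from-≡ eq)))

_≟ᴹ_ : DecidableEquality (Maybe (ℕ × ℕ))
_≟ᴹ_ = Data.Maybe.Properties.≡-dec (Data.Product.Properties.≡-dec _≟_ _≟_)

𝟙 : Bool → ℕ
𝟙 b = if b then 1 else 0

𝟙≤1 : ∀ b → 𝟙 b ≤ 1
𝟙≤1 true  = s≤s z≤n
𝟙≤1 false = z≤n

T⇒1≤𝟙 : ∀ {b} → T b → 1 ≤ 𝟙 b
T⇒1≤𝟙 {true} _ = ≤-refl

1≤𝟙⇒T : ∀ {b} → 1 ≤ 𝟙 b → T b
1≤𝟙⇒T {true} _ = _

∑-mono-≤ : ∀ {n} {f g : Fin n → ℕ} → (∀ i → f i ≤ g i) → ∑[ i < n ] f i ≤ ∑[ i < n ] g i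
∑-mono-≤ {zero}  _   = z≤n
∑-mono-≤ {suc n} f≤g = +-mono-≤ (f≤g 0F) (∑-mono-≤ (f≤g ∘ fsuc))

∑-cong : ∀ {n} {f g : Fin n → ℕ} → (∀ i → f i ≡ g i) → ∑[ i < n ] f i ≡ ∑[ i < n ] g i
∑-cong {zero}  _   = refl
∑-cong {suc n} f≡g = cong₂ _+_ (f≡g 0F) (∑-cong (f≡g ∘ fsuc))

∑-zero : ∀ {n} {f : Fin n → ℕ} → (∀ i → f i ≡ 0) → ∑[ i < n ] f i ≡ 0
∑-zero {zero}  _   = refl
∑-zero {suc n} f≡0 = cong₂ _+_ (f≡0 0F) (∑-zero (f≡0 ∘ fsuc))

∑-const : ∀ n c → ∑[ i < n ] c ≡ n * c
∑-const zero    c = refl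
∑-const (suc n) c = cong (c +_) (∑-const n c)

term≤∑ : ∀ {n} (f : Fin n → ℕ) i → f i ≤ ∑[ j < n ] f j
term≤∑ f 0F    = m≤m+n _ _
term≤∑ f (fsuc i) = ≤-trans (term≤∑ (f ∘ fsuc) i) (m≤n+m _ _)

∑-𝟙-unique : ∀ {n} (b : Fin n → Bool) → (∀ i j → T (b i) → T (b j) → i ≡ j) →
             ∑[ i < n ] 𝟙 (b i) ≤ 1
∑-𝟙-unique {zero}  b unique = z≤n
∑-𝟙-unique {suc n} b unique with b 0F in b₀
... | false = ∑-𝟙-unique (b ∘ fsuc) (λ i j bi bj → fsuc-injective (unique _ _ bi bj))
... | true  = s≤s (≤-reflexive (∑-zero rest))
  where
  rest : ∀ i → 𝟙 (b (fsuc i)) ≡ 0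
  rest i with b (fsuc i) in bᵢ
  ... | false = refl
  ... | true with unique 0F (fsuc i) (T-from-≡ b₀) (T-from-≡ bᵢ)
  ... | ()

∑-point-≤ : ∀ N t (f : ℕ → ℕ) → ∑[ p < N ] (if toℕ p ≡ᵇ t then f (toℕ p) else 0) ≤ f t
∑-point-≤ zero    t       f = z≤n
∑-point-≤ (suc N) zero    f = ≤-reflexive (trans (cong (f 0 +_) (∑-zero {N} (λ _ → refl))) (+-identityʳ (f 0)))
∑-point-≤ (suc N) (suc t) f = ∑-point-≤ N t (f ∘ suc)

∑-point : ∀ N t c → t < N → ∑[ p < N ] (if toℕ p ≡ᵇ t then c else 0) ≡ c
∑-point (suc N) zero    c _         = trans (cong (c +_) (∑-zero {N} (λ _ → refl))) (+-identityʳ c)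
∑-point (suc N) (suc t) c (s≤s t<N) = ∑-point N t c t<N

∑-split : ∀ a b (f : ℕ → ℕ) →
          ∑[ t < a + b ] f (toℕ t) ≡ ∑[ t < a ] f (toℕ t) + ∑[ t < b ] f (a + toℕ t)
∑-split zero    b f = refl
∑-split (suc a) b f = trans (cong (f 0 +_) (∑-split a b (f ∘ suc))) (sym (+-assoc (f 0) _ _))

∑-prefix-≤ : ∀ {a b} (f : ℕ → ℕ) → a ≤ b → ∑[ t < a ] f (toℕ t) ≤ ∑[ t < b ] f (toℕ t)
∑-prefix-≤ {a} {b} f a≤b = begin
  ∑[ t < a ] f (toℕ t)                                       ≤⟨ m≤m+n _ _ ⟩
  ∑[ t < a ] f (toℕ t) + ∑[ t < b ∸ a ] f (a + toℕ t)       ≡⟨ ∑-split a (b ∸ a) f ⟨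
  ∑[ t < a + (b ∸ a) ] f (toℕ t)                             ≡⟨ cong (λ z → ∑[ t < z ] f (toℕ t)) (m+[n∸m]≡n a≤b) ⟩
  ∑[ t < b ] f (toℕ t)                                       ∎
  where open ≤-Reasoning

sum-tabulate : ∀ {n} (f : Fin n → ℕ) → List.sum (tabulate f) ≡ ∑[ i < n ] f i
sum-tabulate {zero}  f = refl
sum-tabulate {suc n} f = cong (f 0F +_) (sum-tabulate (f ∘ fsuc))

sum-map-allFin : ∀ n (f : Fin n → ℕ) → List.sum (map f (allFin n)) ≡ ∑[ i < n ] f i
sum-map-allFin n f = trans (cong List.sum (map-tabulate id f)) (sum-tabulate f)

∑-empty : ∀ {n} (f : Fin n → ℕ) → n ≡ 0 → ∑[ i < n ] f i ≡ 0
∑-empty f refl = refl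

∑-𝟙-≟ : ∀ {k} (i : Fin k) → ∑[ j < k ] 𝟙 (does (i ≟ᶠ j)) ≡ 1
∑-𝟙-≟ {suc k} 0F       = cong suc (∑-zero {k} λ _ → refl)
∑-𝟙-≟ {suc k} (fsuc i) = ∑-𝟙-≟ i

∑-𝟙-∧-≟ : ∀ {k} b (i : Fin k) → ∑[ j < k ] 𝟙 (b ∧ does (i ≟ᶠ j)) ≡ 𝟙 b
∑-𝟙-∧-≟ {k} false i = ∑-zero {k} λ _ → refl
∑-𝟙-∧-≟     true  i = ∑-𝟙-≟ i

combine-cancel : ∀ {k l} (i i' : Fin k) (a a' : Fin l) →
                 l * toℕ i + toℕ a ≡ l * toℕ i' + toℕ a' → i ≡ i' × a ≡ a'
combine-cancel i i' a a' e =
  combine-injective i a i' a' (toℕ-injective (trans (toℕ-combine i a) (trans e (sym (toℕ-combine i' a')))))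

transpose-≡ : ∀ {N} (i j : Fin N) → PC.transpose i j i ≡ j
transpose-≡ i j rewrite dec-true (i ≟ᶠ i) refl = refl

transpose-fix : ∀ {N} (i j k : Fin N) → k ≢ i → k ≢ j → PC.transpose i j k ≡ k
transpose-fix i j k k≢i k≢j rewrite dec-false (k ≟ᶠ i) k≢i | dec-false (k ≟ᶠ j) k≢j = refl

permutation-extending : ∀ {K N} (P Q : Fin K → Fin N) → Injective _≡_ _≡_ P → Injective _≡_ _≡_ Q →
                        Σ[ π ∈ Permutation′ N ] (∀ i → π ⟨$⟩ʳ P i ≡ Q i)
permutation-extending {zero}  P Q _    _    = Perm.id , λ ()
permutation-extending {suc K} P Q injP injQ = π ∘ₚ transpose a (Q 0F) , extends
  where
  rest = permutation-extending (P ∘ fsuc) (Q ∘ fsuc) (fsuc-injective ∘ injP) (fsuc-injective ∘ injQ)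
  π = proj₁ rest
  a = π ⟨$⟩ʳ P 0F
  extends : ∀ i → PC.transpose a (Q 0F) (π ⟨$⟩ʳ P i) ≡ Q i
  extends 0F       = transpose-≡ a (Q 0F)
  extends (fsuc i) = trans (cong (PC.transpose a (Q 0F)) (proj₂ rest i)) (transpose-fix a (Q 0F) (Q (fsuc i)) ≢a ≢Q0)
    where
    ≢a : Q (fsuc i) ≢ a
    ≢a e with injP (trans (sym (inverseˡ π)) (trans (cong (π ⟨$⟩ˡ_) (trans (proj₂ rest i) e)) (inverseˡ π)))
    ... | ()
    ≢Q0 : Q (fsuc i) ≢ Q 0F
    ≢Q0 e with injQ e
    ... | ()

-- Single-elimination tournaments

2^suc : ∀ k → 2 ^ suc k ≡ 2 ^ k + 2 ^ k
2^suc k = cong (2 ^ k +_) (+-identityʳ (2 ^ k))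

module Knockout (v : ℕ → ℕ → ℕ → ℕ) (s : ℕ → ℕ) where

  winner value : ℕ → ℕ → ℕ
  winner k off = proj₁ (run v s k off)
  value  k off = proj₂ (run v s k off)

  final : ℕ → ℕ → ℕ
  final k off = v (winner k off) (winner k (off + 2 ^ k)) (suc k)

  halves≤value : ∀ k off → value k off + value k (off + 2 ^ k) ≤ value (suc k) off
  halves≤value k off = m≤m+n _ _

  value≤value-suc : ∀ k off → value k off ≤ value (suc k) off
  value≤value-suc k off = ≤-trans (m≤m+n _ _) (halves≤value k off)

  -- the games at the nodes on the path from seat off to the root of its 2 ^ k-block
  leftPath : ℕ → ℕ → ℕ
  leftPath zero    off = 0
  leftPath (suc k) off = leftPath k off + final k off

  leftPath≤value : ∀ k off → leftPath k off ≤ value k off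
  leftPath≤value zero    off = z≤n
  leftPath≤value (suc k) off =
    +-monoˡ-≤ (final k off) (≤-trans (leftPath≤value k off) (m≤m+n _ _))

  ∑-blocks≤value : ∀ j i off → ∑[ t < 2 ^ j ] value i (off + 2 ^ i * toℕ t) ≤ value (j + i) off
  ∑-blocks≤value zero    i off = ≤-reflexive (trans (+-identityʳ _) (cong (value i) (trans (cong (off +_) (*-zeroʳ (2 ^ i))) (+-identityʳ off))))
  ∑-blocks≤value (suc j) i off = begin
    ∑[ t < 2 ^ suc j ] block off (toℕ t)
      ≡⟨ cong (λ z → ∑[ t < z ] block off (toℕ t)) (2^suc j) ⟩
    ∑[ t < 2 ^ j + 2 ^ j ] block off (toℕ t)
      ≡⟨ ∑-split (2 ^ j) (2 ^ j) (block off) ⟩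
    ∑[ t < 2 ^ j ] block off (toℕ t) + ∑[ t < 2 ^ j ] block off (2 ^ j + toℕ t)
      ≡⟨ cong (∑[ t < 2 ^ j ] block off (toℕ t) +_) (∑-cong {2 ^ j} (cong (value i) ∘ shift ∘ toℕ)) ⟩
    ∑[ t < 2 ^ j ] block off (toℕ t) + ∑[ t < 2 ^ j ] block (off + 2 ^ (j + i)) (toℕ t)
      ≤⟨ +-mono-≤ (∑-blocks≤value j i off) (∑-blocks≤value j i (off + 2 ^ (j + i))) ⟩
    value (j + i) off + value (j + i) (off + 2 ^ (j + i))
      ≤⟨ halves≤value (j + i) off ⟩
    value (suc j + i) off ∎
    where
    open ≤-Reasoning
    block : ℕ → ℕ → ℕ
    block o t = value i (o + 2 ^ i * t)
    shift : ∀ t → off + 2 ^ i * (2 ^ j + t) ≡ off + 2 ^ (j + i) + 2 ^ i * t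
    shift t = begin-equality
      off + 2 ^ i * (2 ^ j + t)           ≡⟨ cong (off +_) (*-distribˡ-+ (2 ^ i) (2 ^ j) t) ⟩
      off + (2 ^ i * 2 ^ j + 2 ^ i * t)   ≡⟨ +-assoc off _ _ ⟨
      off + 2 ^ i * 2 ^ j + 2 ^ i * t     ≡⟨ cong (λ z → off + z + 2 ^ i * t) (trans (*-comm (2 ^ i) (2 ^ j)) (sym (^-distribˡ-+-* 2 j i))) ⟩
      off + 2 ^ (j + i) + 2 ^ i * t       ∎

module Elimination (v : ℕ → ℕ → ℕ → ℕ) (v-sym : ∀ a b r → v a b r ≡ v b a r)
                   (s : ℕ → ℕ) (N : ℕ)
                   (s-injective : ∀ p q → p < N → q < N → s p ≡ s q → p ≡ q)
                   (s-<N : ∀ p → p < N → s p < N) where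

  open Knockout v s using (winner; value)

  Seated : ℕ → ℕ → ℕ → Set
  Seated k off p = ∃ λ q → off ≤ q × q < off + 2 ^ k × s q ≡ p

  -- eliminator k off p ≡ just (q , j): in the block of 2 ^ k seats from off, p lost to q in round j.
  eliminator : ℕ → ℕ → ℕ → Maybe (ℕ × ℕ)
  eliminator zero    off p = nothing
  eliminator (suc k) off p =
    if p ≡ᵇ (winner k off ⊓ winner k (off + 2 ^ k))
    then just (winner k off ⊔ winner k (off + 2 ^ k) , suc k)
    else eliminator k off p <∣> eliminator k (off + 2 ^ k) p

  valueOfLoss : ℕ → Maybe (ℕ × ℕ) → ℕ
  valueOfLoss p (just (q , j)) = v p q j
  valueOfLoss p nothing        = 0

  lostValue : ℕ → ℕ → ℕ → ℕ
  lostValue k off p = valueOfLoss p (eliminator k off p)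

  record Invariant (k off : ℕ) : Set where
    field
      winner-seated        : Seated k off (winner k off)
      winner-unbeaten      : eliminator k off (winner k off) ≡ nothing
      eliminated-sound     : ∀ p q j → eliminator k off p ≡ just (q , j) →
                             Seated k off p × Seated k off q × p < q × 1 ≤ j × j ≤ k
      eliminator-injective : ∀ p p' q j → eliminator k off p ≡ just (q , j) →
                             eliminator k off p' ≡ just (q , j) → p ≡ p'
      eliminated-earlier   : ∀ p q j p' j' → eliminator k off p ≡ just (q , j) →
                             eliminator k off p' ≡ just (p , j') → j' < j
      value-≡-∑lost        : value k off ≡ ∑[ p < N ] lostValue k off (toℕ p)

  2^k≤2^suc : ∀ k → 2 ^ k ≤ 2 ^ suc k
  2^k≤2^suc k = subst (2 ^ k ≤_) (sym (2^suc k)) (m≤m+n _ _)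

  halves-end : ∀ off k → off + 2 ^ k + 2 ^ k ≡ off + 2 ^ suc k
  halves-end off k = trans (+-assoc off _ _) (cong (off +_) (sym (2^suc k)))

  left-fits : ∀ k off → off + 2 ^ suc k ≤ N → off + 2 ^ k ≤ N
  left-fits k off = ≤-trans (+-monoʳ-≤ off (2^k≤2^suc k))

  right-fits : ∀ k off → off + 2 ^ suc k ≤ N → off + 2 ^ k + 2 ^ k ≤ N
  right-fits k off = subst (_≤ N) (sym (halves-end off k))

  seated-left : ∀ k off p → Seated k off p → Seated (suc k) off p
  seated-left k off p (q , off≤q , q< , sq) = q , off≤q , <-≤-trans q< (+-monoʳ-≤ off (2^k≤2^suc k)) , sq

  seated-right : ∀ k off p → Seated k (off + 2 ^ k) p → Seated (suc k) off p
  seated-right k off p (q , off≤q , q< , sq) =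
    q , ≤-trans (m≤m+n off _) off≤q , subst (q <_) (halves-end off k) q< , sq

  seated-disjoint : ∀ k off p → off + 2 ^ suc k ≤ N → Seated k off p → Seated k (off + 2 ^ k) p → ⊥
  seated-disjoint k off p fits (q₁ , _ , q₁< , sq₁) (q₂ , q₂≥ , q₂< , sq₂) =
    <⇒≢ (<-≤-trans q₁< q₂≥)
        (s-injective q₁ q₂ (<-≤-trans q₁< (left-fits k off fits)) (<-≤-trans q₂< (right-fits k off fits))
                     (trans sq₁ (sym sq₂)))

  seated<N : ∀ k off p → off + 2 ^ k ≤ N → Seated k off p → p < N
  seated<N k off p fits (q , _ , q< , sq) = subst (_< N) sq (s-<N q (<-≤-trans q< fits))

  invariant-base : ∀ off → Invariant 0 off
  invariant-base off = record
    { winner-seated        = off , ≤-refl , subst (off <_) (+-comm 1 off) ≤-refl , refl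
    ; winner-unbeaten      = refl
    ; eliminated-sound     = λ _ _ _ ()
    ; eliminator-injective = λ _ _ _ _ ()
    ; eliminated-earlier   = λ _ _ _ _ _ ()
    ; value-≡-∑lost        = sym (∑-zero {N} λ _ → refl)
    }

  module Step (k off : ℕ) (fits : off + 2 ^ suc k ≤ N)
              (IL : Invariant k off) (IR : Invariant k (off + 2 ^ k)) where
    private
      module IL = Invariant IL
      module IR = Invariant IR

    offR = off + 2 ^ k
    wL = winner k off
    wR = winner k offR
    loser = wL ⊓ wR
    champion = wL ⊔ wR

    disjoint : ∀ p → Seated k off p → Seated k offR p → ⊥
    disjoint p = seated-disjoint k off p fits

    wL≢wR : wL ≢ wR
    wL≢wR e = disjoint wL IL.winner-seated (subst (Seated k offR) (sym e) IR.winner-seated)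

    Sides : Set
    Sides = (loser ≡ wL × champion ≡ wR × wL < wR) ⊎ (loser ≡ wR × champion ≡ wL × wR < wL)

    sides : Sides
    sides with ≤-total wL wR
    ... | inj₁ wL≤wR = inj₁ (m≤n⇒m⊓n≡m wL≤wR , m≤n⇒m⊔n≡n wL≤wR , ≤∧≢⇒< wL≤wR wL≢wR)
    ... | inj₂ wR≤wL = inj₂ (m≥n⇒m⊓n≡n wR≤wL , m≥n⇒m⊔n≡m wR≤wL , ≤∧≢⇒< wR≤wL (≢-sym wL≢wR))

    loser<champion : loser < champion
    loser<champion with sides
    ... | inj₁ (l , c , lt) = subst₂ _<_ (sym l) (sym c) lt
    ... | inj₂ (l , c , lt) = subst₂ _<_ (sym l) (sym c) lt

    loser-seated : Seated (suc k) off loser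
    loser-seated with sides
    ... | inj₁ (l , _ , _) = subst (Seated (suc k) off) (sym l) (seated-left k off wL IL.winner-seated)
    ... | inj₂ (l , _ , _) = subst (Seated (suc k) off) (sym l) (seated-right k off wR IR.winner-seated)

    champion-seated : Seated (suc k) off champion
    champion-seated with sides
    ... | inj₁ (_ , c , _) = subst (Seated (suc k) off) (sym c) (seated-right k off wR IR.winner-seated)
    ... | inj₂ (_ , c , _) = subst (Seated (suc k) off) (sym c) (seated-left k off wL IL.winner-seated)

    unbeaten-right : ∀ p → Seated k off p → eliminator k offR p ≡ nothing
    unbeaten-right p seated with eliminator k offR p in e
    ... | nothing      = refl
    ... | just (q , j) = ⊥-elim (disjoint p seated (proj₁ (IR.eliminated-sound p q j e)))

    unbeaten-left : ∀ p → Seated k offR p → eliminator k off p ≡ nothing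
    unbeaten-left p seated with eliminator k off p in e
    ... | nothing      = refl
    ... | just (q , j) = ⊥-elim (disjoint p (proj₁ (IL.eliminated-sound p q j e)) seated)

    loser-unbeaten-before : eliminator k off loser ≡ nothing × eliminator k offR loser ≡ nothing
    loser-unbeaten-before with sides
    ... | inj₁ (l , _ , _) rewrite l = IL.winner-unbeaten , unbeaten-right wL IL.winner-seated
    ... | inj₂ (l , _ , _) rewrite l = unbeaten-left wR IR.winner-seated , IR.winner-unbeaten

    eliminator-old : ∀ p → p ≢ loser → eliminator (suc k) off p ≡ (eliminator k off p <∣> eliminator k offR p)
    eliminator-old p p≢loser rewrite ≡ᵇ-≢ p loser p≢loser = refl

    eliminator-cases : ∀ p q j → eliminator (suc k) off p ≡ just (q , j) →
                       (p ≡ loser × q ≡ champion × j ≡ suc k)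
                       ⊎ eliminator k off p ≡ just (q , j) ⊎ eliminator k offR p ≡ just (q , j)
    eliminator-cases p q j e with p ≡ᵇ loser in b
    ... | true  = let (q≡ , j≡) = ,-injective (just-injective e) in
                  inj₁ (≡ᵇ⇒≡ p loser (T-from-≡ b) , sym q≡ , sym j≡)
    ... | false with eliminator k off p
    ...   | just _  = inj₂ (inj₁ e)
    ...   | nothing = inj₂ (inj₂ e)

    champion-unbeaten : eliminator (suc k) off champion ≡ nothing
    champion-unbeaten rewrite eliminator-old champion (<⇒≢ loser<champion ∘ sym) with sides
    ... | inj₁ (_ , c , _) rewrite c | unbeaten-left wR IR.winner-seated | IR.winner-unbeaten = refl
    ... | inj₂ (_ , c , _) rewrite c | IL.winner-unbeaten | unbeaten-right wL IL.winner-seated = refl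

    sound : ∀ p q j → eliminator (suc k) off p ≡ just (q , j) →
            Seated (suc k) off p × Seated (suc k) off q × p < q × 1 ≤ j × j ≤ suc k
    sound p q j e with eliminator-cases p q j e
    ... | inj₁ (refl , refl , refl) = loser-seated , champion-seated , loser<champion , s≤s z≤n , ≤-refl
    ... | inj₂ (inj₁ e') = let (sp , sq , p<q , 1≤j , j≤k) = IL.eliminated-sound p q j e' in
      seated-left k off p sp , seated-left k off q sq , p<q , 1≤j , m≤n⇒m≤1+n j≤k
    ... | inj₂ (inj₂ e') = let (sp , sq , p<q , 1≤j , j≤k) = IR.eliminated-sound p q j e' in
      seated-right k off p sp , seated-right k off q sq , p<q , 1≤j , m≤n⇒m≤1+n j≤k

    not-this-round-L : ∀ p q → eliminator k off p ≢ just (q , suc k)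
    not-this-round-L p q e = 1+n≰n (proj₂ (proj₂ (proj₂ (proj₂ (IL.eliminated-sound p q (suc k) e)))))

    not-this-round-R : ∀ p q → eliminator k offR p ≢ just (q , suc k)
    not-this-round-R p q e = 1+n≰n (proj₂ (proj₂ (proj₂ (proj₂ (IR.eliminated-sound p q (suc k) e)))))

    injective : ∀ p p' q j → eliminator (suc k) off p ≡ just (q , j) →
                eliminator (suc k) off p' ≡ just (q , j) → p ≡ p'
    injective p p' q j e e' with eliminator-cases p q j e | eliminator-cases p' q j e'
    ... | inj₁ (p≡ , _ , _)         | inj₁ (p'≡ , _ , _)  = trans p≡ (sym p'≡)
    ... | inj₁ (_ , _ , refl)       | inj₂ (inj₁ x)       = ⊥-elim (not-this-round-L p' q x)
    ... | inj₁ (_ , _ , refl)       | inj₂ (inj₂ x)       = ⊥-elim (not-this-round-R p' q x)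
    ... | inj₂ (inj₁ x)             | inj₁ (_ , _ , refl) = ⊥-elim (not-this-round-L p q x)
    ... | inj₂ (inj₂ x)             | inj₁ (_ , _ , refl) = ⊥-elim (not-this-round-R p q x)
    ... | inj₂ (inj₁ x)             | inj₂ (inj₁ y)       = IL.eliminator-injective p p' q j x y
    ... | inj₂ (inj₂ x)             | inj₂ (inj₂ y)       = IR.eliminator-injective p p' q j x y
    ... | inj₂ (inj₁ x)             | inj₂ (inj₂ y)       =
      ⊥-elim (disjoint q (proj₁ (proj₂ (IL.eliminated-sound p q j x))) (proj₁ (proj₂ (IR.eliminated-sound p' q j y))))
    ... | inj₂ (inj₂ x)             | inj₂ (inj₁ y)       =
      ⊥-elim (disjoint q (proj₁ (proj₂ (IL.eliminated-sound p' q j y))) (proj₁ (proj₂ (IR.eliminated-sound p q j x))))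

    earlier : ∀ p q j p' j' → eliminator (suc k) off p ≡ just (q , j) →
              eliminator (suc k) off p' ≡ just (p , j') → j' < j
    earlier p q j p' j' e e' with eliminator-cases p' p j' e'
    ... | inj₁ (_ , refl , _) with trans (sym e) champion-unbeaten
    ...   | ()
    earlier p q j p' j' e e' | inj₂ (inj₁ x) with eliminator-cases p q j e
    ... | inj₁ (_ , _ , refl) = s≤s (proj₂ (proj₂ (proj₂ (proj₂ (IL.eliminated-sound p' p j' x)))))
    ... | inj₂ (inj₁ y)       = IL.eliminated-earlier p q j p' j' y x
    ... | inj₂ (inj₂ y)       = ⊥-elim (disjoint p (proj₁ (proj₂ (IL.eliminated-sound p' p j' x))) (proj₁ (IR.eliminated-sound p q j y)))
    earlier p q j p' j' e e' | inj₂ (inj₂ x) with eliminator-cases p q j e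
    ... | inj₁ (_ , _ , refl) = s≤s (proj₂ (proj₂ (proj₂ (proj₂ (IR.eliminated-sound p' p j' x)))))
    ... | inj₂ (inj₂ y)       = IR.eliminated-earlier p q j p' j' y x
    ... | inj₂ (inj₁ y)       = ⊥-elim (disjoint p (proj₁ (IL.eliminated-sound p q j y)) (proj₁ (proj₂ (IR.eliminated-sound p' p j' x))))

    final-value : v loser champion (suc k) ≡ v wL wR (suc k)
    final-value with sides
    ... | inj₁ (l , c , _) rewrite l | c = refl
    ... | inj₂ (l , c , _) rewrite l | c = v-sym wR wL (suc k)

    lostValue-step : ∀ p → lostValue (suc k) off p ≡
                     lostValue k off p + lostValue k offR p + (if p ≡ᵇ loser then v wL wR (suc k) else 0)
    lostValue-step p with p ≡ᵇ loser in b
    ... | true with ≡ᵇ⇒≡ p loser (T-from-≡ b)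
    ...   | refl rewrite proj₁ loser-unbeaten-before | proj₂ loser-unbeaten-before = final-value
    lostValue-step p | false rewrite +-identityʳ (lostValue k off p + lostValue k offR p)
      with eliminator k off p in eL | eliminator k offR p in eR
    ... | nothing     | _           = refl
    ... | just _      | nothing     = sym (+-identityʳ _)
    ... | just (q , j) | just (q' , j') =
      ⊥-elim (disjoint p (proj₁ (IL.eliminated-sound p q j eL)) (proj₁ (IR.eliminated-sound p q' j' eR)))

    value-step : value (suc k) off ≡ ∑[ p < N ] lostValue (suc k) off (toℕ p)
    value-step = sym (begin
      ∑[ p < N ] lostValue (suc k) off (toℕ p)
        ≡⟨ ∑-cong {N} (lostValue-step ∘ toℕ) ⟩
      ∑[ p < N ] (lostValue k off (toℕ p) + lostValue k offR (toℕ p) + final p)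
        ≡⟨ ∑-distrib-+ {N} (λ p → lostValue k off (toℕ p) + lostValue k offR (toℕ p)) final ⟩
      ∑[ p < N ] (lostValue k off (toℕ p) + lostValue k offR (toℕ p)) + ∑[ p < N ] final p
        ≡⟨ cong₂ _+_ (∑-distrib-+ {N} (lostValue k off ∘ toℕ) (lostValue k offR ∘ toℕ))
                     (∑-point N loser _ (seated<N (suc k) off loser fits loser-seated)) ⟩
      ∑[ p < N ] lostValue k off (toℕ p) + ∑[ p < N ] lostValue k offR (toℕ p) + v wL wR (suc k)
        ≡⟨ cong (_+ v wL wR (suc k)) (cong₂ _+_ IL.value-≡-∑lost IR.value-≡-∑lost) ⟨
      value k off + value k offR + v wL wR (suc k) ∎)
      where
      open ≡-Reasoning
      final : Fin N → ℕ
      final p = if toℕ p ≡ᵇ loser then v wL wR (suc k) else 0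

    invariant : Invariant (suc k) off
    invariant = record
      { winner-seated        = champion-seated
      ; winner-unbeaten      = champion-unbeaten
      ; eliminated-sound     = sound
      ; eliminator-injective = injective
      ; eliminated-earlier   = earlier
      ; value-≡-∑lost        = value-step
      }

  invariant : ∀ k off → off + 2 ^ k ≤ N → Invariant k off
  invariant zero    off _    = invariant-base off
  invariant (suc k) off fits =
    Step.invariant k off fits (invariant k off (left-fits k off fits)) (invariant k (off + 2 ^ k) (right-fits k off fits))

seat-≡ : ∀ N σ p (p<N : p < N) → seat N σ p ≡ toℕ (σ ⟨$⟩ˡ fromℕ< p<N)
seat-≡ N σ p p<N with p <? N
... | yes _   = refl
... | no p≮N = ⊥-elim (p≮N p<N)

seat-<N : ∀ N σ p → p < N → seat N σ p < N
seat-<N N σ p p<N rewrite seat-≡ N σ p p<N = toℕ<n _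

seat-injective : ∀ N σ p q → p < N → q < N → seat N σ p ≡ seat N σ q → p ≡ q
seat-injective N σ p q p<N q<N e rewrite seat-≡ N σ p p<N | seat-≡ N σ q q<N =
  trans (sym (toℕ-fromℕ< p<N)) (trans (cong toℕ positions-≡) (toℕ-fromℕ< q<N))
  where
  positions-≡ : fromℕ< p<N ≡ fromℕ< q<N
  positions-≡ = trans (sym (inverseʳ σ)) (trans (cong (σ ⟨$⟩ʳ_) (toℕ-injective e)) (inverseʳ σ))

hasLit : ∀ {k} → Bool → Fin k → Literal k → Bool
hasLit pol x l = does (proj₁ l ≟ᶠ x) ∧ (if pol then proj₂ l else not (proj₂ l))

hasLit⇒does : ∀ {k} pol (x : Fin k) l → T (hasLit pol x l) → T (does (proj₁ l ≟ᶠ x))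
hasLit⇒does pol x l h = proj₁ (T-∧⁻ h)

module _ (φ : Formula) where

  clauseSat : Assignment φ → Fin (nClauses φ) → Bool
  clauseSat a c = litVal φ a (proj₁ (clause φ c)) ∨ litVal φ a (proj₂ (clause φ c))

  numSat≡∑ : ∀ a → numSat φ a ≡ ∑[ c < nClauses φ ] 𝟙 (clauseSat a c)
  numSat≡∑ a = sum-map-allFin (nClauses φ) (𝟙 ∘ clauseSat a)

  hasLit⇒litVal : ∀ (a : Assignment φ) pol x l → T (hasLit pol x l) → a x ≡ pol → T (litVal φ a l)
  hasLit⇒litVal a pol x (y , s) h ax with y ≟ᶠ x
  ... | no _ = ⊥-elim h
  ... | yes refl with pol | s
  ...   | true  | true  = T-from-≡ ax
  ...   | false | false = subst (T ∘ not) (sym ax) _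

  hasLit⇒clauseSat : ∀ (a : Assignment φ) pol x c →
                     T (hasLit pol x (proj₁ (clause φ c)) ∨ hasLit pol x (proj₂ (clause φ c))) →
                     a x ≡ pol → T (clauseSat a c)
  hasLit⇒clauseSat a pol x c h ax with T-∨⁻ {hasLit pol x (proj₁ (clause φ c))} h
  ... | inj₁ h₁ = T-∨⁺ˡ (hasLit⇒litVal a pol x _ h₁ ax)
  ... | inj₂ h₂ = T-∨⁺ʳ (hasLit⇒litVal a pol x _ h₂ ax)

  litVal⇒hasLit : ∀ (a : Assignment φ) l → T (litVal φ a l) → T (hasLit (a (proj₁ l)) (proj₁ l) l)
  litVal⇒hasLit a (y , s) h with y ≟ᶠ y | a y | s
  ... | no y≢y | _     | _     = ⊥-elim (y≢y refl)
  ... | yes _  | true  | true  = _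
  ... | yes _  | false | false = _
  ... | yes _  | true  | false = ⊥-elim h
  ... | yes _  | false | true  = ⊥-elim h

  hasLit⇒occursB : ∀ pol x c → T (hasLit pol x (proj₁ (clause φ c)) ∨ hasLit pol x (proj₂ (clause φ c))) →
                   T (occursB φ x c)
  hasLit⇒occursB pol x c h with T-∨⁻ {hasLit pol x (proj₁ (clause φ c))} h
  ... | inj₁ h₁ = T-∨⁺ˡ (hasLit⇒does pol x (proj₁ (clause φ c)) h₁)
  ... | inj₂ h₂ = T-∨⁺ʳ {does (proj₁ (proj₁ (clause φ c)) ≟ᶠ x)} (hasLit⇒does pol x (proj₂ (clause φ c)) h₂)

  clauses≤3n : Is23 φ → nClauses φ ≤ 3 * nVars φ
  clauses≤3n is23 = begin
    m                                        ≡⟨ trans (sym (*-identityʳ m)) (sym (∑-const m 1)) ⟩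
    ∑[ c < m ] 1                             ≤⟨ ∑-mono-≤ {m} (λ c → ≤-trans (T⇒1≤𝟙 (first-occurs c)) (term≤∑ (λ x → 𝟙 (occursB φ x c)) (firstVar c))) ⟩
    ∑[ c < m ] ∑[ x < n ] 𝟙 (occursB φ x c)  ≡⟨ ∑-comm {m} {n} _ ⟩
    ∑[ x < n ] ∑[ c < m ] 𝟙 (occursB φ x c)  ≡⟨ ∑-cong {n} (λ x → sum-map-allFin m (𝟙 ∘ occursB φ x)) ⟨
    ∑[ x < n ] occurrences φ x               ≤⟨ ∑-mono-≤ {n} is23 ⟩
    ∑[ x < n ] 3                             ≡⟨ trans (∑-const n 3) (*-comm n 3) ⟩
    3 * n                                    ∎
    where
    open ≤-Reasoning
    n = nVars φ
    m = nClauses φ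
    firstVar : Fin m → Fin n
    firstVar c = proj₁ (proj₁ (clause φ c))
    first-occurs : ∀ c → T (occursB φ (firstVar c) c)
    first-occurs c = T-∨⁺ˡ {does (firstVar c ≟ᶠ firstVar c)} (T-from-≡ (dec-true (firstVar c ≟ᶠ firstVar c) refl))

≤-from-≤1 : ∀ {a b} → a ≤ 1 → (1 ≤ a → 1 ≤ b) → a ≤ b
≤-from-≤1 {zero}        _        _         = z≤n
≤-from-≤1 {suc zero}    _        1≤a⇒1≤b = 1≤a⇒1≤b ≤-refl
≤-from-≤1 {suc (suc a)} (s≤s ()) _

smaller≤1 : ∀ A B → A ≤ B → A + B ≤ 3 → A ≤ 1
smaller≤1 A B A≤B A+B≤3 = ≮⇒≥ λ 2≤A → ≤⇒≯ A+B≤3 (begin-strict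
  3      <⟨ ≤-refl ⟩
  4      ≤⟨ +-mono-≤ 2≤A 2≤A ⟩
  A + A  ≤⟨ +-monoʳ-≤ A A≤B ⟩
  A + B  ∎)
  where open ≤-Reasoning

pair≤1+⊔ : ∀ A B → A + B ≤ 3 → A + B ≤ 1 + (A ⊔ B)
pair≤1+⊔ A B A+B≤3 with ≤-total A B
... | inj₁ A≤B rewrite m≤n⇒m⊔n≡n A≤B = +-monoˡ-≤ B (smaller≤1 A B A≤B A+B≤3)
... | inj₂ B≤A rewrite m≥n⇒m⊔n≡m B≤A =
  subst (_≤ 1 + A) (+-comm B A) (+-monoˡ-≤ A (smaller≤1 B A B≤A (subst (_≤ 3) (+-comm A B) A+B≤3)))

-- t, f: values lost by x^T and x^F; A, B: clauses eliminated by x^T and x^F.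
loss-budget : ∀ t f A B → t ≤ 1 → f ≤ 1 → (1 ≤ t → 1 ≤ f → ⊥) → (1 ≤ t → A ≡ 0) → (1 ≤ f → B ≡ 0) →
              A + B ≤ 3 → t + f + (A + B) ≤ 1 + (A ⊔ B)
loss-budget (suc (suc _)) _             _ _ (s≤s ()) _        _    _   _   _
loss-budget _             (suc (suc _)) _ _ _        (s≤s ()) _    _   _   _
loss-budget zero          zero          A B _        _        _    _   _   A+B≤3 = pair≤1+⊔ A B A+B≤3
loss-budget (suc zero)    zero          A B _        _        _    A≡0 _   _ rewrite A≡0 ≤-refl = ≤-refl
loss-budget zero          (suc zero)    A B _        _        _    _   B≡0 _ rewrite B≡0 ≤-refl =
  s≤s (≤-reflexive (trans (+-identityʳ A) (sym (⊔-identityʳ A))))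
loss-budget (suc zero)    (suc zero)    _ _ _        _        both _   _   _ = ⊥-elim (both ≤-refl ≤-refl)

exponent-split : ∀ n r → 16 * n ≤ 2 ^ r → n ≡ 0 ⊎ ∃ λ r' → r ≡ r' + 4 × n ≤ 2 ^ r'
exponent-split zero    r _   = inj₁ refl
exponent-split (suc n) r big with 4 ≤? r
... | no  4≰r = ⊥-elim (<⇒≱ (^-monoʳ-< 2 (s≤s (s≤s z≤n)) (≰⇒> 4≰r)) (≤-trans (*-monoʳ-≤ 16 (s≤s (z≤n {n}))) big))
... | yes 4≤r = inj₂ (r ∸ 4 , sym (m∸n+n≡m 4≤r) , *-cancelʳ-≤ (suc n) (2 ^ (r ∸ 4)) 16 (begin
  suc n * 16        ≡⟨ *-comm (suc n) 16 ⟩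
  16 * suc n        ≤⟨ big ⟩
  2 ^ r             ≡⟨ cong (2 ^_) (m∸n+n≡m 4≤r) ⟨
  2 ^ (r ∸ 4 + 4)   ≡⟨ ^-distribˡ-+-* 2 (r ∸ 4) 4 ⟩
  2 ^ (r ∸ 4) * 16  ∎))
  where open ≤-Reasoning

room-for-players : ∀ n m r → m ≤ 3 * n → 16 * n ≤ 2 ^ r → 3 * n + m < 2 ^ r
room-for-players zero    m r m≤0 _ rewrite n≤0⇒n≡0 m≤0 = m^n>0 2 r
room-for-players (suc n) m r m≤3n big = begin-strict
  3 * suc n + m          ≤⟨ +-monoʳ-≤ (3 * suc n) m≤3n ⟩
  3 * suc n + 3 * suc n  ≡⟨ *-distribʳ-+ (suc n) 3 3 ⟨
  6 * suc n              <⟨ *-monoˡ-< (suc n) {6} {16} (s≤s (s≤s (s≤s (s≤s (s≤s (s≤s (s≤s z≤n))))))) ⟩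
  16 * suc n             ≤⟨ big ⟩
  2 ^ r                  ∎
  where open ≤-Reasoning

room-for-dummies : ∀ n m r → m ≤ 3 * n → 16 * n ≤ 2 ^ r → 7 * n + (3 * n + m) ≤ 2 ^ r
room-for-dummies n m r m≤3n big = begin
  7 * n + (3 * n + m)      ≤⟨ +-monoʳ-≤ (7 * n) (+-monoʳ-≤ (3 * n) m≤3n) ⟩
  7 * n + (3 * n + 3 * n)  ≡⟨ cong (7 * n +_) (*-distribʳ-+ n 3 3) ⟨
  7 * n + 6 * n            ≡⟨ *-distribʳ-+ n 7 6 ⟨
  13 * n                   ≤⟨ *-monoˡ-≤ n (m≤m+n 13 3) ⟩
  16 * n                   ≤⟨ big ⟩
  2 ^ r                    ∎
  where open ≤-Reasoning

-- The tournament T_φ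

module Players (φ : Formula) (ord : AppOrder φ) (r : ℕ) (room : 3 * nVars φ + nClauses φ < 2 ^ r) where
  open Construction φ ord r public

  n m : ℕ
  n = nVars φ
  m = nClauses φ

  -- Every non-dummy player is top t for its rank t < 3 n + m in the strength order.
  top : ℕ → ℕ
  top t = N ∸ suc t

  top-injective : ∀ {t t'} → t < N → t' < N → top t ≡ top t' → t ≡ t'
  top-injective t<N t'<N e = suc-injective (∸-cancelˡ-≡ t<N t'<N e)

  top<N : ∀ {t} → t < N → top t < N
  top<N t<N = ∸-monoʳ-< (s≤s z≤n) t<N

  top-< : ∀ {t t'} → t < t' → t' < N → top t' < top t
  top-< t<t' t'<N = ∸-monoʳ-< (s≤s t<t') t'<N

  varRank : Fin 3 → Fin n → ℕ
  varRank a i = 3 * toℕ i + toℕ a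

  varRank<3n : ∀ a i → varRank a i < 3 * n
  varRank<3n a i = <-≤-trans (+-monoʳ-< (3 * toℕ i) (toℕ<n a))
                             (subst (_≤ 3 * n) (trans (*-suc 3 (toℕ i)) (+-comm 3 _)) (*-monoʳ-≤ 3 (toℕ<n i)))

  varRank<N : ∀ a i → varRank a i < N
  varRank<N a i = <-trans (<-≤-trans (varRank<3n a i) (m≤m+n (3 * n) m)) room

  clauseRank<N : ∀ c → 3 * n + toℕ c < N
  clauseRank<N c = <-trans (+-monoʳ-< (3 * n) (toℕ<n c)) room

  varPlayer : Fin 3 → Fin n → ℕ
  varPlayer 0F = X
  varPlayer 1F = XT
  varPlayer 2F = XF

  litKind : Bool → Fin 3
  litKind true  = 1F
  litKind false = 2F

  litPlayer : Bool → Fin n → ℕ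
  litPlayer pol = varPlayer (litKind pol)

  signB : Bool → Fin n → Fin m → Bool
  signB true  = posB φ
  signB false = negB φ

  varPlayer≡top : ∀ a i → varPlayer a i ≡ top (varRank a i)
  varPlayer≡top a i = begin
    varPlayer a i                   ≡⟨ unfold a ⟩
    N ∸ suc (toℕ a) ∸ 3 * toℕ i     ≡⟨ ∸-+-assoc N (suc (toℕ a)) (3 * toℕ i) ⟩
    N ∸ suc (toℕ a + 3 * toℕ i)     ≡⟨ cong (λ t → N ∸ suc t) (+-comm (toℕ a) (3 * toℕ i)) ⟩
    top (varRank a i)               ∎
    where
    open ≡-Reasoning
    unfold : ∀ a → varPlayer a i ≡ N ∸ suc (toℕ a) ∸ 3 * toℕ i
    unfold 0F = refl
    unfold 1F = refl
    unfold 2F = refl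

  C≡top : ∀ c → C c ≡ top (3 * n + toℕ c)
  C≡top c = trans (∸-+-assoc (N ∸ 1) (3 * n) (toℕ c)) (∸-+-assoc N 1 (3 * n + toℕ c))

  varPlayer-injective : ∀ a i a' i' → varPlayer a i ≡ varPlayer a' i' → a ≡ a' × i ≡ i'
  varPlayer-injective a i a' i' e =
    let (i≡ , a≡) = combine-cancel i i' a a'
                      (top-injective (varRank<N a i) (varRank<N a' i')
                                     (trans (sym (varPlayer≡top a i)) (trans e (varPlayer≡top a' i'))))
    in a≡ , i≡

  C-injective : ∀ c c' → C c ≡ C c' → c ≡ c'
  C-injective c c' e = toℕ-injective (+-cancelˡ-≡ (3 * n) _ _
    (top-injective (clauseRank<N c) (clauseRank<N c') (trans (sym (C≡top c)) (trans e (C≡top c')))))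

  C<varPlayer : ∀ c a i → C c < varPlayer a i
  C<varPlayer c a i = subst₂ _<_ (sym (C≡top c)) (sym (varPlayer≡top a i))
    (top-< (<-≤-trans (varRank<3n a i) (m≤m+n _ _)) (clauseRank<N c))

  litPlayer<X : ∀ pol i → litPlayer pol i < X i
  litPlayer<X pol i = subst₂ _<_ (sym (varPlayer≡top (litKind pol) i)) (sym (varPlayer≡top 0F i))
    (top-< (+-monoʳ-< (3 * toℕ i) (kind-pos pol)) (varRank<N (litKind pol) i))
    where
    kind-pos : ∀ pol → 0 < toℕ (litKind pol)
    kind-pos true  = s≤s z≤n
    kind-pos false = s≤s z≤n

  litPlayer-injective : ∀ pol i pol' i' → litPlayer pol i ≡ litPlayer pol' i' → pol ≡ pol' × i ≡ i'
  litPlayer-injective pol i pol' i' e with varPlayer-injective _ i _ i' e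
  ... | a≡ , i≡ = kind-injective pol pol' a≡ , i≡
    where
    kind-injective : ∀ pol pol' → litKind pol ≡ litKind pol' → pol ≡ pol'
    kind-injective true  true  _ = refl
    kind-injective false false _ = refl

  gameValue-sym : ∀ a b rd → gameValue a b rd ≡ gameValue b a rd
  gameValue-sym a b rd rewrite ∨-comm (gvB a b rd) (gvB b a rd) = refl

  gameValue≤1 : ∀ a b rd → gameValue a b rd ≤ 1
  gameValue≤1 a b rd = 𝟙≤1 (gvB a b rd ∨ gvB b a rd)

  -- Games of value 1 in which b is the weaker player.
  VariableGame : ℕ → ℕ → ℕ → Set
  VariableGame a b rd = ∃ λ i → a ≡ X i × (∃ λ pol → b ≡ litPlayer pol i) × rd ≡ 1

  ClauseGame : Fin m → Fin n → ℕ → ℕ → Set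
  ClauseGame c x b rd = T (occursB φ x c) × rd ≡ suc (toℕ (ord x c))
                        × ∃ λ pol → T (signB pol x c) × b ≡ litPlayer pol x

  private
    ≡ᵇ⁻ : ∀ {a b} → T (a ≡ᵇ b) → a ≡ b
    ≡ᵇ⁻ = ≡ᵇ⇒≡ _ _

    ≡ᵇ⁺ : ∀ {a b} → a ≡ b → T (a ≡ᵇ b)
    ≡ᵇ⁺ = ≡⇒≡ᵇ _ _

    literal⁻ : ∀ b i → T ((b ≡ᵇ XT i) ∨ (b ≡ᵇ XF i)) → ∃ λ pol → b ≡ litPlayer pol i
    literal⁻ b i h with T-∨⁻ h
    ... | inj₁ e = true  , ≡ᵇ⁻ e
    ... | inj₂ e = false , ≡ᵇ⁻ e

    literal⁺ : ∀ b i pol → b ≡ litPlayer pol i → T ((b ≡ᵇ XT i) ∨ (b ≡ᵇ XF i))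
    literal⁺ b i true  e = T-∨⁺ˡ (≡ᵇ⁺ e)
    literal⁺ b i false e = T-∨⁺ʳ (≡ᵇ⁺ e)

    signed⁻ : ∀ b x c → T ((posB φ x c ∧ (b ≡ᵇ XT x)) ∨ (negB φ x c ∧ (b ≡ᵇ XF x))) →
              ∃ λ pol → T (signB pol x c) × b ≡ litPlayer pol x
    signed⁻ b x c h with T-∨⁻ h
    ... | inj₁ h' = true  , proj₁ (T-∧⁻ h') , ≡ᵇ⁻ (proj₂ (T-∧⁻ h'))
    ... | inj₂ h' = false , proj₁ (T-∧⁻ h') , ≡ᵇ⁻ (proj₂ (T-∧⁻ h'))

    signed⁺ : ∀ b x c pol → T (signB pol x c) → b ≡ litPlayer pol x →
              T ((posB φ x c ∧ (b ≡ᵇ XT x)) ∨ (negB φ x c ∧ (b ≡ᵇ XF x)))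
    signed⁺ b x c true  s e = T-∨⁺ˡ (T-∧⁺ s (≡ᵇ⁺ e))
    signed⁺ b x c false s e = T-∨⁺ʳ (T-∧⁺ s (≡ᵇ⁺ e))

  gvB⇒game : ∀ a b rd → T (gvB a b rd) →
             VariableGame a b rd ⊎ ∃ λ c → a ≡ C c × ∃ λ x → ClauseGame c x b rd
  gvB⇒game a b rd h with T-∨⁻ h
  ... | inj₁ hv =
    let (i , hi) = T-any-allFin⁻ _ hv
        (a≡ , rest) = T-∧⁻ hi
        (lit , rd≡) = T-∧⁻ rest
    in inj₁ (i , ≡ᵇ⁻ a≡ , literal⁻ b i lit , ≡ᵇ⁻ rd≡)
  ... | inj₂ hc =
    let (c , hc') = T-any-allFin⁻ _ hc
        (x , hx) = T-any-allFin⁻ _ hc'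
        (a≡ , rest) = T-∧⁻ hx
        (occ , rest') = T-∧⁻ rest
        (rd≡ , sgn) = T-∧⁻ rest'
    in inj₂ (c , ≡ᵇ⁻ a≡ , x , occ , ≡ᵇ⁻ rd≡ , signed⁻ b x c sgn)

  variableGame⇒gvB : ∀ a b rd → VariableGame a b rd → T (gvB a b rd)
  variableGame⇒gvB a b rd (i , a≡ , (pol , b≡) , rd≡) =
    T-∨⁺ˡ (T-any-allFin⁺ _ i (T-∧⁺ (≡ᵇ⁺ a≡) (T-∧⁺ (literal⁺ b i pol b≡) (≡ᵇ⁺ rd≡))))

  clauseGame⇒gvB : ∀ c x b rd → ClauseGame c x b rd → T (gvB (C c) b rd)
  clauseGame⇒gvB c x b rd (occ , rd≡ , pol , sgn , b≡) =
    T-∨⁺ʳ (T-any-allFin⁺ _ c (T-any-allFin⁺ _ x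
      (T-∧⁺ (≡ᵇ⁺ {C c} refl) (T-∧⁺ occ (T-∧⁺ (≡ᵇ⁺ rd≡) (signed⁺ b x c pol sgn b≡))))))

  gvB⇒gameValue : ∀ a b rd → T (gvB a b rd) → gameValue a b rd ≡ 1
  gvB⇒gameValue a b rd h rewrite Equivalence.to T-≡ h = refl

  gvB⇒gameValueʳ : ∀ a b rd → T (gvB b a rd) → gameValue a b rd ≡ 1
  gvB⇒gameValueʳ a b rd h = trans (gameValue-sym a b rd) (gvB⇒gameValue b a rd h)

  gameValue⇒gvB : ∀ a b rd → 1 ≤ gameValue a b rd → T (gvB a b rd) ⊎ T (gvB b a rd)
  gameValue⇒gvB a b rd h = T-∨⁻ (1≤𝟙⇒T h)

  signB≡hasLit : ∀ pol x c → signB pol x c ≡ hasLit pol x (proj₁ (clause φ c)) ∨ hasLit pol x (proj₂ (clause φ c))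
  signB≡hasLit true  x c = refl
  signB≡hasLit false x c = refl

-- The upper bound

module UpperBound (φ : Formula) (ord : AppOrder φ) (r : ℕ) (room : 3 * nVars φ + nClauses φ < 2 ^ r)
                  (is23 : Is23 φ) (σ : Permutation′ (2 ^ r)) where
  open Players φ ord r room
  open Elimination gameValue gameValue-sym (seat N σ) N (seat-injective N σ) (seat-<N N σ)

  private
    module I = Invariant (invariant r 0 ≤-refl)

  beaten : ℕ → Maybe (ℕ × ℕ)
  beaten = eliminator r 0

  lost : ℕ → ℕ
  lost = lostValue r 0

  lost≤1 : ∀ p → lost p ≤ 1
  lost≤1 p with eliminator r 0 p
  ... | nothing      = z≤n
  ... | just (q , j) = gameValue≤1 p q j

  lost-positive : ∀ p → 1 ≤ lost p → ∃ λ q → ∃ λ j → beaten p ≡ just (q , j) × 1 ≤ gameValue p q j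
  lost-positive p g with eliminator r 0 p
  ... | just (q , j) = q , j , refl , g
  ... | nothing with g
  ...   | ()

  ValuableLoss : ℕ → ℕ → ℕ → Set
  ValuableLoss p q j = (∃ λ i → ∃ λ pol → p ≡ litPlayer pol i × q ≡ X i × j ≡ 1)
                       ⊎ (∃ λ c → p ≡ C c × ∃ λ x → ClauseGame c x q j)

  valuable-loss : ∀ p q j → beaten p ≡ just (q , j) → 1 ≤ gameValue p q j → ValuableLoss p q j
  valuable-loss p q j e g with proj₁ (proj₂ (proj₂ (I.eliminated-sound p q j e))) | gameValue⇒gvB p q j g
  ... | p<q | inj₁ h with gvB⇒game p q j h
  ...   | inj₁ (i , p≡ , (pol , q≡) , _) = ⊥-elim (<-asym p<q (subst₂ _<_ (sym q≡) (sym p≡) (litPlayer<X pol i)))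
  ...   | inj₂ clauseGame                = inj₂ clauseGame
  valuable-loss p q j e g | p<q | inj₂ h with gvB⇒game q p j h
  ...   | inj₁ (i , q≡ , (pol , p≡) , j≡)          = inj₁ (i , pol , p≡ , q≡ , j≡)
  ...   | inj₂ (c , q≡ , x , _ , _ , pol , _ , p≡) =
    ⊥-elim (<-asym p<q (subst₂ _<_ (sym q≡) (sym p≡) (C<varPlayer c (litKind pol) x)))

  at : ℕ → ℕ → ℕ
  at t p = if p ≡ᵇ t then lost p else 0

  1≤at : ∀ {p t} → p ≡ t → 1 ≤ lost p → 1 ≤ at t p
  1≤at {p} refl g rewrite ≡ᵇ-refl p = g

  attributed : ℕ → ℕ
  attributed p = ∑[ i < n ] (at (XT i) p + at (XF i) p) + ∑[ c < m ] at (C c) p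

  lost≤attributed : ∀ p → lost p ≤ attributed p
  lost≤attributed p = ≤-from-≤1 (lost≤1 p) λ g → let (q , j , e , g') = lost-positive p g in
                                                 via (valuable-loss p q j e g') g
    where
    via : ∀ {q j} → ValuableLoss p q j → 1 ≤ lost p → 1 ≤ attributed p
    via (inj₁ (i , true , p≡ , _)) g =
      ≤-trans (1≤at p≡ g) (≤-trans (m≤m+n _ _) (≤-trans (term≤∑ _ i) (m≤m+n _ _)))
    via (inj₁ (i , false , p≡ , _)) g =
      ≤-trans (1≤at p≡ g) (≤-trans (m≤n+m _ _) (≤-trans (term≤∑ _ i) (m≤m+n _ _)))
    via (inj₂ (c , p≡ , _)) g =
      ≤-trans (1≤at p≡ g) (≤-trans (term≤∑ _ c) (m≤n+m _ _))

  total≤attributed : ∑[ p < N ] lost (toℕ p) ≤ ∑[ i < n ] (lost (XT i) + lost (XF i)) + ∑[ c < m ] lost (C c)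
  total≤attributed = begin
    ∑[ p < N ] lost (toℕ p)
      ≤⟨ ∑-mono-≤ {N} (lost≤attributed ∘ toℕ) ⟩
    ∑[ p < N ] attributed (toℕ p)
      ≡⟨ ∑-distrib-+ {N} _ _ ⟩
    ∑[ p < N ] ∑[ i < n ] (at (XT i) (toℕ p) + at (XF i) (toℕ p)) + ∑[ p < N ] ∑[ c < m ] at (C c) (toℕ p)
      ≡⟨ cong₂ _+_ (∑-comm {N} {n} _) (∑-comm {N} {m} _) ⟩
    ∑[ i < n ] ∑[ p < N ] (at (XT i) (toℕ p) + at (XF i) (toℕ p)) + ∑[ c < m ] ∑[ p < N ] at (C c) (toℕ p)
      ≤⟨ +-mono-≤ (∑-mono-≤ {n} literals) (∑-mono-≤ {m} (λ c → ∑-point-≤ N (C c) lost)) ⟩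
    ∑[ i < n ] (lost (XT i) + lost (XF i)) + ∑[ c < m ] lost (C c) ∎
    where
    open ≤-Reasoning
    literals : ∀ i → ∑[ p < N ] (at (XT i) (toℕ p) + at (XF i) (toℕ p)) ≤ lost (XT i) + lost (XF i)
    literals i = ≤-trans (≤-reflexive (∑-distrib-+ {N} _ _)) (+-mono-≤ (∑-point-≤ N (XT i) lost) (∑-point-≤ N (XF i) lost))

  BeatenInRound : Bool → Fin n → Fin m → Set
  BeatenInRound pol x c = beaten (C c) ≡ just (litPlayer pol x , suc (toℕ (ord x c)))

  beatenInRound? : ∀ pol x c → Dec (BeatenInRound pol x c)
  beatenInRound? pol x c = beaten (C c) ≟ᴹ just (litPlayer pol x , suc (toℕ (ord x c)))

  beatenBy : Bool → Fin n → Fin m → Bool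
  beatenBy pol x c = does (beatenInRound? pol x c) ∧ (occursB φ x c ∧ signB pol x c)

  beatenBy⁻ : ∀ pol x c → T (beatenBy pol x c) → BeatenInRound pol x c × T (occursB φ x c) × T (signB pol x c)
  beatenBy⁻ pol x c h = let (e , rest) = T-∧⁻ {does (beatenInRound? pol x c)} h in
                        does⇒ (beatenInRound? pol x c) e , T-∧⁻ {occursB φ x c} rest

  beatenBy⁺ : ∀ pol x c → BeatenInRound pol x c → T (occursB φ x c) → T (signB pol x c) → T (beatenBy pol x c)
  beatenBy⁺ pol x c e occ sgn = T-∧⁺ {does (beatenInRound? pol x c)} (does⇐ (beatenInRound? pol x c) e) (T-∧⁺ occ sgn)

  beatenBy-unique : ∀ pol x pol' x' c → T (beatenBy pol x c) → T (beatenBy pol' x' c) → pol ≡ pol' × x ≡ x'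
  beatenBy-unique pol x pol' x' c h h' = litPlayer-injective pol x pol' x'
    (proj₁ (,-injective (just-injective (trans (sym (proj₁ (beatenBy⁻ pol x c h))) (proj₁ (beatenBy⁻ pol' x' c h'))))))

  eliminated : Bool → Fin n → ℕ
  eliminated pol x = ∑[ c < m ] 𝟙 (beatenBy pol x c)

  lost-clause≤ : ∀ c → lost (C c) ≤ ∑[ x < n ] (𝟙 (beatenBy true x c) + 𝟙 (beatenBy false x c))
  lost-clause≤ c = ≤-from-≤1 (lost≤1 (C c)) λ g → let (q , j , e , g') = lost-positive (C c) g in
                                                 via q j e (valuable-loss (C c) q j e g')
    where
    either≤ : ∀ pol x → 𝟙 (beatenBy pol x c) ≤ 𝟙 (beatenBy true x c) + 𝟙 (beatenBy false x c)
    either≤ true  x = m≤m+n _ _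
    either≤ false x = m≤n+m _ _
    via : ∀ q j → beaten (C c) ≡ just (q , j) → ValuableLoss (C c) q j →
          1 ≤ ∑[ x < n ] (𝟙 (beatenBy true x c) + 𝟙 (beatenBy false x c))
    via q j e (inj₁ (i , pol , C≡ , _)) = ⊥-elim (<⇒≢ (C<varPlayer c (litKind pol) i) C≡)
    via q j e (inj₂ (c' , C≡ , x , occ , j≡ , pol , sgn , q≡)) with C-injective c c' C≡
    ... | refl = ≤-trans (T⇒1≤𝟙 (beatenBy⁺ pol x c (trans e (cong₂ (λ a b → just (a , b)) q≡ j≡)) occ sgn))
                         (≤-trans (either≤ pol x) (term≤∑ _ x))

  ∑lost-clauses≤ : ∑[ c < m ] lost (C c) ≤ ∑[ x < n ] (eliminated true x + eliminated false x)
  ∑lost-clauses≤ = begin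
    ∑[ c < m ] lost (C c)
      ≤⟨ ∑-mono-≤ {m} lost-clause≤ ⟩
    ∑[ c < m ] ∑[ x < n ] (𝟙 (beatenBy true x c) + 𝟙 (beatenBy false x c))
      ≡⟨ ∑-comm {m} {n} _ ⟩
    ∑[ x < n ] ∑[ c < m ] (𝟙 (beatenBy true x c) + 𝟙 (beatenBy false x c))
      ≡⟨ ∑-cong {n} (λ x → ∑-distrib-+ {m} _ _) ⟩
    ∑[ x < n ] (eliminated true x + eliminated false x) ∎
    where open ≤-Reasoning

  literal-loss : ∀ pol x → 1 ≤ lost (litPlayer pol x) → beaten (litPlayer pol x) ≡ just (X x , 1)
  literal-loss pol x g with lost-positive _ g
  ... | q , j , e , g' with valuable-loss _ q j e g'
  ...   | inj₂ (c , p≡ , _) = ⊥-elim (<⇒≢ (C<varPlayer c (litKind pol) x) (sym p≡))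
  ...   | inj₁ (i , pol' , p≡ , q≡ , j≡) with litPlayer-injective pol x pol' i p≡
  ...     | refl , refl = trans e (cong₂ (λ a b → just (a , b)) q≡ j≡)

  one-literal-loses : ∀ x → 1 ≤ lost (XT x) → 1 ≤ lost (XF x) → ⊥
  one-literal-loses x gT gF with litPlayer-injective true x false x
    (I.eliminator-injective _ _ _ _ (literal-loss true x gT) (literal-loss false x gF))
  ... | () , _

  -- A literal that loses in round 1 is not in any later game, so it eliminates no clause.
  loser-eliminates-none : ∀ pol x → 1 ≤ lost (litPlayer pol x) → eliminated pol x ≡ 0
  loser-eliminates-none pol x g = ∑-zero {m} none
    where
    none : ∀ c → 𝟙 (beatenBy pol x c) ≡ 0
    none c with beatenBy pol x c in b
    ... | false = refl
    ... | true with I.eliminated-earlier _ _ _ _ _ (literal-loss pol x g) (proj₁ (beatenBy⁻ pol x c (T-from-≡ b)))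
    ...   | s≤s ()

  appearances : ∀ x → eliminated true x + eliminated false x ≤ 3
  appearances x = begin
    eliminated true x + eliminated false x             ≡⟨ ∑-distrib-+ {m} _ _ ⟨
    ∑[ c < m ] (𝟙 (beatenBy true x c) + 𝟙 (beatenBy false x c))  ≤⟨ ∑-mono-≤ {m} at-most-one ⟩
    ∑[ c < m ] 𝟙 (occursB φ x c)                        ≡⟨ sum-map-allFin m (𝟙 ∘ occursB φ x) ⟨
    occurrences φ x                                     ≤⟨ is23 x ⟩
    3                                                   ∎
    where
    open ≤-Reasoning
    at-most-one : ∀ c → 𝟙 (beatenBy true x c) + 𝟙 (beatenBy false x c) ≤ 𝟙 (occursB φ x c)
    at-most-one c with beatenBy true x c in bT | beatenBy false x c in bF
    ... | false | false = z≤n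
    ... | true  | false = T⇒1≤𝟙 (proj₁ (proj₂ (beatenBy⁻ true x c (T-from-≡ bT))))
    ... | false | true  = T⇒1≤𝟙 (proj₁ (proj₂ (beatenBy⁻ false x c (T-from-≡ bF))))
    ... | true  | true with beatenBy-unique true x false x c (T-from-≡ bT) (T-from-≡ bF)
    ...   | () , _

  assignment : Assignment φ
  assignment x = eliminated false x ≤ᵇ eliminated true x

  eliminated-by-assignment : ∀ x → eliminated (assignment x) x ≡ eliminated true x ⊔ eliminated false x
  eliminated-by-assignment x with assignment x in e
  ... | true  = sym (m≥n⇒m⊔n≡m (≤ᵇ⇒≤ _ _ (T-from-≡ e)))
  ... | false = sym (m≤n⇒m⊔n≡n (<⇒≤ (≰⇒> λ le → subst T e (≤⇒≤ᵇ le))))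

  variable-bound : ∀ x → lost (XT x) + lost (XF x) + (eliminated true x + eliminated false x)
                         ≤ 1 + eliminated (assignment x) x
  variable-bound x rewrite eliminated-by-assignment x =
    loss-budget _ _ _ _ (lost≤1 _) (lost≤1 _) (one-literal-loses x)
                (loser-eliminates-none true x) (loser-eliminates-none false x) (appearances x)

  ∑eliminated≤numSat : ∑[ x < n ] eliminated (assignment x) x ≤ numSat φ assignment
  ∑eliminated≤numSat = begin
    ∑[ x < n ] ∑[ c < m ] 𝟙 (beatenBy (assignment x) x c)  ≡⟨ ∑-comm {n} {m} _ ⟩
    ∑[ c < m ] ∑[ x < n ] 𝟙 (beatenBy (assignment x) x c)  ≤⟨ ∑-mono-≤ {m} per-clause ⟩
    ∑[ c < m ] 𝟙 (clauseSat φ assignment c)                ≡⟨ numSat≡∑ φ assignment ⟨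
    numSat φ assignment                                    ∎
    where
    open ≤-Reasoning
    satisfies : ∀ x c → T (beatenBy (assignment x) x c) → T (clauseSat φ assignment c)
    satisfies x c h = hasLit⇒clauseSat φ assignment (assignment x) x c
      (subst T (signB≡hasLit (assignment x) x c) (proj₂ (proj₂ (beatenBy⁻ (assignment x) x c h)))) refl
    per-clause : ∀ c → ∑[ x < n ] 𝟙 (beatenBy (assignment x) x c) ≤ 𝟙 (clauseSat φ assignment c)
    per-clause c with clauseSat φ assignment c in sat
    ... | true  = ∑-𝟙-unique _ λ x x' h h' → proj₂ (beatenBy-unique (assignment x) x (assignment x') x' c h h')
    ... | false = ≤-reflexive (∑-zero {n} none)
      where
      none : ∀ x → 𝟙 (beatenBy (assignment x) x c) ≡ 0
      none x with beatenBy (assignment x) x c in b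
      ... | false = refl
      ... | true  = ⊥-elim (subst T sat (satisfies x c (T-from-≡ b)))

  upper-bound : tvalue r gameValue σ ≤ n + numSat φ assignment
  upper-bound = begin
    tvalue r gameValue σ
      ≡⟨ I.value-≡-∑lost ⟩
    ∑[ p < N ] lost (toℕ p)
      ≤⟨ total≤attributed ⟩
    ∑[ i < n ] (lost (XT i) + lost (XF i)) + ∑[ c < m ] lost (C c)
      ≤⟨ +-monoʳ-≤ (∑[ i < n ] (lost (XT i) + lost (XF i))) ∑lost-clauses≤ ⟩
    ∑[ x < n ] (lost (XT x) + lost (XF x)) + ∑[ x < n ] (eliminated true x + eliminated false x)
      ≡⟨ ∑-distrib-+ {n} _ _ ⟨
    ∑[ x < n ] (lost (XT x) + lost (XF x) + (eliminated true x + eliminated false x))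
      ≤⟨ ∑-mono-≤ {n} variable-bound ⟩
    ∑[ x < n ] (1 + eliminated (assignment x) x)
      ≡⟨ ∑-distrib-+ {n} _ _ ⟩
    ∑[ x < n ] 1 + ∑[ x < n ] eliminated (assignment x) x
      ≤⟨ +-mono-≤ (≤-reflexive (trans (∑-const n 1) (*-identityʳ n))) ∑eliminated≤numSat ⟩
    n + numSat φ assignment ∎
    where open ≤-Reasoning

-- The optimal seeding

module LowerBound (φ : Formula) (ord : AppOrder φ) (valid : ValidOrder φ ord) (r : ℕ)
                  (room : 3 * nVars φ + nClauses φ < 2 ^ r)
                  (spare : 7 * nVars φ + (3 * nVars φ + nClauses φ) ≤ 2 ^ r)
                  (big : 16 * nVars φ ≤ 2 ^ r) (a₀ : Assignment φ) where
  open Players φ ord r room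

  dummy : Fin n → Fin 7 → ℕ
  dummy x t = 7 * toℕ x + toℕ t

  dummy<7n : ∀ x t → dummy x t < 7 * n
  dummy<7n x t = subst₂ _<_ (toℕ-combine x t) (*-comm n 7) (toℕ<n (combine x t))

  7n≤top : ∀ t → t < 3 * n + m → 7 * n ≤ top t
  7n≤top t t< = ≤-trans (m+n≤o⇒m≤o∸n (7 * n) spare) (∸-monoʳ-≤ N t<)

  dummy<C : ∀ x t c → dummy x t < C c
  dummy<C x t c = subst (dummy x t <_) (sym (C≡top c))
    (<-≤-trans (dummy<7n x t) (7n≤top _ (+-monoʳ-< (3 * n) (toℕ<n c))))

  dummy<varPlayer : ∀ x t a i → dummy x t < varPlayer a i
  dummy<varPlayer x t a i = subst (dummy x t <_) (sym (varPlayer≡top a i))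
    (<-≤-trans (dummy<7n x t) (7n≤top _ (<-≤-trans (varRank<3n a i) (m≤m+n _ _))))

  data Role : Set where
    var    : Fin 3 → Fin n → Role
    clause′ : Fin m → Role
    filler : Fin n → Fin 7 → Role

  player : Role → ℕ
  player (var a i)    = varPlayer a i
  player (clause′ c)  = C c
  player (filler x t) = dummy x t

  player-injective : ∀ d d' → player d ≡ player d' → d ≡ d'
  player-injective (var a i)    (var a' i')    e = let (a≡ , i≡) = varPlayer-injective a i a' i' e in cong₂ var a≡ i≡
  player-injective (var a i)    (clause′ c)    e = ⊥-elim (<⇒≢ (C<varPlayer c a i) (sym e))
  player-injective (var a i)    (filler x t)   e = ⊥-elim (<⇒≢ (dummy<varPlayer x t a i) (sym e))
  player-injective (clause′ c)  (var a i)      e = ⊥-elim (<⇒≢ (C<varPlayer c a i) e)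
  player-injective (clause′ c)  (clause′ c')   e = cong clause′ (C-injective c c' e)
  player-injective (clause′ c)  (filler x t)   e = ⊥-elim (<⇒≢ (dummy<C x t c) (sym e))
  player-injective (filler x t) (var a i)      e = ⊥-elim (<⇒≢ (dummy<varPlayer x t a i) e)
  player-injective (filler x t) (clause′ c)    e = ⊥-elim (<⇒≢ (dummy<C x t c) e)
  player-injective (filler x t) (filler x' t') e = let (x≡ , t≡) = combine-cancel x x' t t' e in cong₂ filler x≡ t≡

  player<N : ∀ d → player d < N
  player<N (var a i)    = subst (_< N) (sym (varPlayer≡top a i)) (top<N (varRank<N a i))
  player<N (clause′ c)  = subst (_< N) (sym (C≡top c)) (top<N (clauseRank<N c))
  player<N (filler x t) = <-≤-trans (dummy<7n x t) (≤-trans (m≤m+n _ _) spare)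

  chosenLit : Fin m → Literal n
  chosenLit c = if litVal φ a₀ (proj₁ (clause φ c)) then proj₁ (clause φ c) else proj₂ (clause φ c)

  chosen : Fin m → Fin n
  chosen c = proj₁ (chosenLit c)

  -- A satisfied clause is assigned to the variable of its first true literal,
  -- and meets that literal in the round of its appearance.
  assigned : Fin m → Fin n → Bool
  assigned c x = clauseSat φ a₀ c ∧ does (chosen c ≟ᶠ x)

  slotted : Fin n → Fin 3 → Fin m → Bool
  slotted x j c = assigned c x ∧ does (ord x c ≟ᶠ j)

  slot? : ∀ x j → Dec (∃ λ c → T (slotted x j c))
  slot? x j = any? λ c → T? (slotted x j c)

  first-true : ∀ (l₁ l₂ : Literal n) → T (litVal φ a₀ l₁ ∨ litVal φ a₀ l₂) →
               T (litVal φ a₀ (if litVal φ a₀ l₁ then l₁ else l₂))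
  first-true l₁ l₂ sat with litVal φ a₀ l₁ in e
  ... | true  = T-from-≡ e
  ... | false = sat

  first-true-in-clause : ∀ pol x (l₁ l₂ : Literal n) → T (hasLit pol x (if litVal φ a₀ l₁ then l₁ else l₂)) →
                         T (hasLit pol x l₁ ∨ hasLit pol x l₂)
  first-true-in-clause pol x l₁ l₂ h with litVal φ a₀ l₁
  ... | true  = T-∨⁺ˡ h
  ... | false = T-∨⁺ʳ {hasLit pol x l₁} h

  slotted⇒ : ∀ x j c → T (slotted x j c) → ord x c ≡ j × T (occursB φ x c) × T (signB (a₀ x) x c)
  slotted⇒ x j c h with T-∧⁻ {assigned c x} h
  ... | as , ordered with T-∧⁻ {clauseSat φ a₀ c} as
  ...   | sat , ch with does⇒ (chosen c ≟ᶠ x) ch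
  ...     | refl = does⇒ (ord x c ≟ᶠ j) ordered , hasLit⇒occursB φ (a₀ x) x c inClause ,
                   subst T (sym (signB≡hasLit (a₀ x) x c)) inClause
    where
    l₁ = proj₁ (clause φ c)
    l₂ = proj₂ (clause φ c)
    inClause = first-true-in-clause (a₀ x) x l₁ l₂ (litVal⇒hasLit φ a₀ (chosenLit c) (first-true l₁ l₂ sat))

  slotted-unique : ∀ x j c c' → T (slotted x j c) → T (slotted x j c') → c ≡ c'
  slotted-unique x j c c' h h' = let (o , occ , _) = slotted⇒ x j c h ; (o' , occ' , _) = slotted⇒ x j c' h' in
    proj₁ valid x c c' occ occ' (trans o (sym o'))

  slotted-total : ∑[ x < n ] ∑[ j < 3 ] ∑[ c < m ] 𝟙 (slotted x j c) ≡ numSat φ a₀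
  slotted-total = begin
    ∑[ x < n ] ∑[ j < 3 ] ∑[ c < m ] 𝟙 (slotted x j c)  ≡⟨ ∑-cong {n} (λ x → ∑-comm {3} {m} (λ j c → 𝟙 (slotted x j c))) ⟩
    ∑[ x < n ] ∑[ c < m ] ∑[ j < 3 ] 𝟙 (slotted x j c)  ≡⟨ ∑-cong {n} (λ x → ∑-cong {m} λ c → ∑-𝟙-∧-≟ (assigned c x) (ord x c)) ⟩
    ∑[ x < n ] ∑[ c < m ] 𝟙 (assigned c x)              ≡⟨ ∑-comm {n} {m} (λ x c → 𝟙 (assigned c x)) ⟩
    ∑[ c < m ] ∑[ x < n ] 𝟙 (assigned c x)              ≡⟨ ∑-cong {m} (λ c → ∑-𝟙-∧-≟ (clauseSat φ a₀ c) (chosen c)) ⟩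
    ∑[ c < m ] 𝟙 (clauseSat φ a₀ c)                     ≡⟨ numSat≡∑ φ a₀ ⟨
    numSat φ a₀                                          ∎
    where open ≡-Reasoning

  fill : ∀ {x j} → Dec (∃ λ c → T (slotted x j c)) → Role → Role
  fill (yes (c , _)) _ = clause′ c
  fill (no _)        d = d

  -- Block of variable x: seat 0 holds x and seat 1 its false literal, which x beats in round 1;
  -- seats 8 .. 15 hold the true literal, which meets its slotted clauses in rounds 1, 2 and 3.
  -- Seats 2 .. 7 receive whatever players the extension to a permutation leaves over.
  layout : Fin n → Fin 10 → Role
  layout x 0F = var 0F x
  layout x 1F = var (litKind (not (a₀ x))) x
  layout x 2F = var (litKind (a₀ x)) x
  layout x 3F = fill (slot? x 0F) (filler x 0F)
  layout x 4F = fill (slot? x 1F) (filler x 1F)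
  layout x 5F = filler x 2F
  layout x 6F = fill (slot? x 2F) (filler x 3F)
  layout x 7F = filler x 4F
  layout x 8F = filler x 5F
  layout x 9F = filler x 6F

  offset : Fin 10 → Fin 16
  offset 0F              = 0F
  offset 1F              = 1F
  offset (fsuc (fsuc k)) = 8 ↑ʳ k

  offset-injective : ∀ k k' → offset k ≡ offset k' → k ≡ k'
  offset-injective 0F              0F               _    = refl
  offset-injective 1F              1F               _    = refl
  offset-injective (fsuc (fsuc k)) (fsuc (fsuc k')) refl = refl
  offset-injective 0F              1F               ()
  offset-injective 0F              (fsuc (fsuc _))  ()
  offset-injective 1F              0F               ()
  offset-injective 1F              (fsuc (fsuc _))  ()
  offset-injective (fsuc (fsuc _)) 0F               ()
  offset-injective (fsuc (fsuc _)) 1F               ()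

  slotIndex : Fin 3 → Fin 10
  slotIndex 0F = 3F
  slotIndex 1F = 4F
  slotIndex 2F = 6F

  unlayout : Role → Fin n × Fin 10
  unlayout (var 0F i)   = i , 0F
  unlayout (var 1F i)   = i , (if a₀ i then 2F else 1F)
  unlayout (var 2F i)   = i , (if a₀ i then 1F else 2F)
  unlayout (clause′ c)  = chosen c , slotIndex (ord (chosen c) c)
  unlayout (filler x t) = x , 3 ↑ʳ t

  unlayout-fill : ∀ x j t → 3 ↑ʳ t ≡ slotIndex j → unlayout (fill (slot? x j) (filler x t)) ≡ (x , slotIndex j)
  unlayout-fill x j t t≡ with slot? x j
  ... | no _         = cong (x ,_) t≡
  ... | yes (c , sc) with T-∧⁻ {assigned c x} sc
  ...   | as , _ with does⇒ (chosen c ≟ᶠ x) (proj₂ (T-∧⁻ {clauseSat φ a₀ c} as))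
  ...     | refl = cong (λ j → chosen c , slotIndex j) (proj₁ (slotted⇒ x j c sc))

  unlayout-layout : ∀ x k → unlayout (layout x k) ≡ (x , k)
  unlayout-layout x 0F = refl
  unlayout-layout x 1F with a₀ x in e
  ... | true  rewrite e = refl
  ... | false rewrite e = refl
  unlayout-layout x 2F with a₀ x in e
  ... | true  rewrite e = refl
  ... | false rewrite e = refl
  unlayout-layout x 3F = unlayout-fill x 0F 0F refl
  unlayout-layout x 4F = unlayout-fill x 1F 1F refl
  unlayout-layout x 5F = refl
  unlayout-layout x 6F = unlayout-fill x 2F 3F refl
  unlayout-layout x 7F = refl
  unlayout-layout x 8F = refl
  unlayout-layout x 9F = refl

  position : Fin n → Fin 10 → ℕ
  position x k = 16 * toℕ x + toℕ (offset k)

  position<N : ∀ x k → position x k < N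
  position<N x k = <-≤-trans (subst (_< n * 16) (toℕ-combine x (offset k)) (toℕ<n (combine x (offset k))))
                             (subst (_≤ N) (*-comm 16 n) big)

  seatOf occupant : Fin n × Fin 10 → Fin N
  seatOf   (x , k) = fromℕ< (position<N x k)
  occupant (x , k) = fromℕ< (player<N (layout x k))

  seatOf-injective : ∀ p p' → seatOf p ≡ seatOf p' → p ≡ p'
  seatOf-injective (x , k) (x' , k') e =
    let (x≡ , o≡) = combine-cancel x x' (offset k) (offset k') (fromℕ<-injective _ _ _ _ e)
    in cong₂ _,_ x≡ (offset-injective k k' o≡)

  occupant-injective : ∀ p p' → occupant p ≡ occupant p' → p ≡ p'
  occupant-injective (x , k) (x' , k') e = begin
    (x , k)                 ≡⟨ unlayout-layout x k ⟨
    unlayout (layout x k)   ≡⟨ cong unlayout (player-injective _ _ (fromℕ<-injective _ _ _ _ e)) ⟩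
    unlayout (layout x' k') ≡⟨ unlayout-layout x' k' ⟩
    (x' , k')               ∎
    where open ≡-Reasoning

  remQuot-injective : ∀ {i j : Fin (n * 10)} → remQuot {n} 10 i ≡ remQuot 10 j → i ≡ j
  remQuot-injective {i} {j} e =
    trans (sym (combine-remQuot {n} 10 i)) (trans (cong (uncurry combine) e) (combine-remQuot {n} 10 j))

  private
    extension : Σ[ π ∈ Permutation′ N ] (∀ i → π ⟨$⟩ʳ seatOf (remQuot {n} 10 i) ≡ occupant (remQuot 10 i))
    extension = permutation-extending (seatOf ∘ remQuot 10) (occupant ∘ remQuot 10)
                  (λ e → remQuot-injective (seatOf-injective _ _ e)) (λ e → remQuot-injective (occupant-injective _ _ e))

  σ : Permutation′ N
  σ = flip (proj₁ extension)

  s : ℕ → ℕ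
  s = seat N σ

  seat-layout : ∀ x k → s (position x k) ≡ player (layout x k)
  seat-layout x k = begin
    s (position x k)                                       ≡⟨ seat-≡ N σ _ (position<N x k) ⟩
    toℕ (proj₁ extension ⟨$⟩ʳ seatOf (x , k))              ≡⟨ cong (λ p → toℕ (proj₁ extension ⟨$⟩ʳ seatOf p)) (remQuot-combine x k) ⟨
    toℕ (proj₁ extension ⟨$⟩ʳ seatOf (remQuot 10 (combine x k)))  ≡⟨ cong toℕ (proj₂ extension (combine x k)) ⟩
    toℕ (occupant (remQuot 10 (combine x k)))              ≡⟨ cong (toℕ ∘ occupant) (remQuot-combine x k) ⟩
    toℕ (occupant (x , k))                                 ≡⟨ toℕ-fromℕ< _ ⟩
    player (layout x k)                                    ∎
    where open ≡-Reasoning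

  open Knockout gameValue s

  module Block (x : Fin n) where
    off o ℓ : ℕ
    off = 16 * toℕ x
    o   = off + 8
    ℓ   = litPlayer (a₀ x) x

    slotPlayer : Fin 3 → Fin 7 → ℕ
    slotPlayer j t = player (fill (slot? x j) (filler x t))

    filled<ℓ : ∀ {j} (d : Dec (∃ λ c → T (slotted x j c))) t → player (fill d (filler x t)) < ℓ
    filled<ℓ (yes (c , _)) t = C<varPlayer c (litKind (a₀ x)) x
    filled<ℓ (no _)        t = dummy<varPlayer x t (litKind (a₀ x)) x

    slotPlayer<ℓ : ∀ j t → slotPlayer j t < ℓ
    slotPlayer<ℓ j = filled<ℓ (slot? x j)

    seat-upper : ∀ (k : Fin 8) {q} → q ≡ o + toℕ k → s q ≡ player (layout x (fsuc (fsuc k)))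
    seat-upper k refl = trans (cong s (+-assoc off 8 (toℕ k))) (seat-layout x (fsuc (fsuc k)))

    winner-round1 : winner 1 o ≡ ℓ
    winner-round1 = trans (cong₂ _⊔_ (seat-upper 0F (sym (+-identityʳ o))) (seat-upper 1F refl))
                          (m≥n⇒m⊔n≡m (<⇒≤ (slotPlayer<ℓ 0F 0F)))

    opponent-round2 : winner 1 (o + 2) ≡ slotPlayer 1F 1F ⊔ dummy x 2F
    opponent-round2 = cong₂ _⊔_ (seat-upper 2F refl) (seat-upper 3F (+-assoc o 2 1))

    winner-round2 : winner 2 o ≡ ℓ
    winner-round2 = trans (cong₂ _⊔_ winner-round1 opponent-round2)
                          (m≥n⇒m⊔n≡m (<⇒≤ (⊔-lub (slotPlayer<ℓ 1F 1F) (dummy<varPlayer x 2F (litKind (a₀ x)) x))))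

    opponent-round3 : winner 2 (o + 4) ≡ (slotPlayer 2F 3F ⊔ dummy x 4F) ⊔ (dummy x 5F ⊔ dummy x 6F)
    opponent-round3 = cong₂ _⊔_ (cong₂ _⊔_ (seat-upper 4F refl) (seat-upper 5F (+-assoc o 4 1)))
                                (cong₂ _⊔_ (seat-upper 6F (+-assoc o 4 2))
                                           (seat-upper 7F (trans (+-assoc (o + 4) 2 1) (+-assoc o 4 3))))

    clause-game : ∀ j c → T (slotted x j c) → gameValue ℓ (C c) (suc (toℕ j)) ≡ 1
    clause-game j c sc = let (ord≡ , occ , sgn) = slotted⇒ x j c sc in
      gvB⇒gameValueʳ ℓ (C c) (suc (toℕ j)) (clauseGame⇒gvB c x ℓ (suc (toℕ j)) (occ , cong (suc ∘ toℕ) (sym ord≡) , a₀ x , sgn , refl))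

    filled-count≤ : ∀ {j} (d : Dec (∃ λ c → T (slotted x j c))) t (g : ℕ → ℕ) →
                    (∀ c → T (slotted x j c) → g (C c) ≡ 1) →
                    ∑[ c < m ] 𝟙 (slotted x j c) ≤ g (player (fill d (filler x t)))
    filled-count≤ {j} (yes (c , sc)) t g g≡1 =
      ≤-trans (∑-𝟙-unique _ (slotted-unique x j)) (≤-reflexive (sym (g≡1 c sc)))
    filled-count≤ {j} (no none) t g g≡1 = ≤-trans (≤-reflexive (∑-zero {m} empty)) z≤n
      where
      empty : ∀ c → 𝟙 (slotted x j c) ≡ 0
      empty c with slotted x j c in e
      ... | false = refl
      ... | true  = ⊥-elim (none (c , T-from-≡ e))

    slot-count≤ : ∀ j t (g : ℕ → ℕ) → (∀ c → T (slotted x j c) → g (C c) ≡ 1) →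
                  ∑[ c < m ] 𝟙 (slotted x j c) ≤ g (slotPlayer j t)
    slot-count≤ j = filled-count≤ (slot? x j)

    round1 : ∑[ c < m ] 𝟙 (slotted x 0F c) ≤ final 0 o
    round1 = ≤-trans (slot-count≤ 0F 0F (λ z → gameValue ℓ z 1) (clause-game 0F))
      (≤-reflexive (sym (cong₂ (λ a b → gameValue a b 1) (seat-upper 0F (sym (+-identityʳ o))) (seat-upper 1F refl))))

    round2 : ∑[ c < m ] 𝟙 (slotted x 1F c) ≤ final 1 o
    round2 = ≤-trans (slot-count≤ 1F 1F (λ z → gameValue ℓ (z ⊔ dummy x 2F) 2) λ c sc →
                       trans (cong (λ z → gameValue ℓ z 2) (m≥n⇒m⊔n≡m (<⇒≤ (dummy<C x 2F c)))) (clause-game 1F c sc))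
      (≤-reflexive (sym (cong₂ (λ a b → gameValue a b 2) winner-round1 opponent-round2)))

    round3 : ∑[ c < m ] 𝟙 (slotted x 2F c) ≤ final 2 o
    round3 = ≤-trans (slot-count≤ 2F 3F (λ z → gameValue ℓ ((z ⊔ dummy x 4F) ⊔ (dummy x 5F ⊔ dummy x 6F)) 3) λ c sc →
                       trans (cong (λ z → gameValue ℓ z 3) (clause-wins c)) (clause-game 2F c sc))
      (≤-reflexive (sym (cong₂ (λ a b → gameValue a b 3) winner-round2 opponent-round3)))
      where
      clause-wins : ∀ c → (C c ⊔ dummy x 4F) ⊔ (dummy x 5F ⊔ dummy x 6F) ≡ C c
      clause-wins c = trans (cong (_⊔ _) (m≥n⇒m⊔n≡m (<⇒≤ (dummy<C x 4F c))))
                            (m≥n⇒m⊔n≡m (<⇒≤ (⊔-lub (dummy<C x 5F c) (dummy<C x 6F c))))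

    variable-round : value 1 off ≡ 1
    variable-round =
      trans (cong₂ (λ a b → gameValue a b 1) (trans (cong s (sym (+-identityʳ off))) (seat-layout x 0F)) (seat-layout x 1F))
            (gvB⇒gameValue (X x) (litPlayer (not (a₀ x)) x) 1
              (variableGame⇒gvB (X x) (litPlayer (not (a₀ x)) x) 1 (x , refl , (not (a₀ x) , refl) , refl)))

    block-value : 1 + ∑[ j < 3 ] ∑[ c < m ] 𝟙 (slotted x j c) ≤ value 4 off
    block-value = begin
      1 + (c₀ + (c₁ + (c₂ + 0)))  ≡⟨ cong (1 +_) (trans (cong (λ z → c₀ + (c₁ + z)) (+-identityʳ c₂)) (sym (+-assoc c₀ c₁ c₂))) ⟩
      1 + (c₀ + c₁ + c₂)          ≤⟨ +-mono-≤ (≤-reflexive (sym variable-round)) (+-mono-≤ (+-mono-≤ round1 round2) round3) ⟩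
      value 1 off + leftPath 3 o  ≤⟨ +-monoʳ-≤ (value 1 off) (leftPath≤value 3 o) ⟩
      value 1 off + value 3 o     ≤⟨ +-monoˡ-≤ (value 3 o) (≤-trans (value≤value-suc 1 off) (value≤value-suc 2 off)) ⟩
      value 3 off + value 3 o     ≤⟨ halves≤value 3 off ⟩
      value 4 off                 ∎
      where
      open ≤-Reasoning
      c₀ c₁ c₂ : ℕ
      c₀ = ∑[ c < m ] 𝟙 (slotted x 0F c)
      c₁ = ∑[ c < m ] 𝟙 (slotted x 1F c)
      c₂ = ∑[ c < m ] 𝟙 (slotted x 2F c)

  ∑blocks≤value : ∀ r' → r ≡ r' + 4 → n ≤ 2 ^ r' → ∑[ x < n ] value 4 (16 * toℕ x) ≤ value r 0
  ∑blocks≤value r' r≡ n≤2^r' = begin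
    ∑[ x < n ] value 4 (16 * toℕ x)       ≤⟨ ∑-prefix-≤ (λ t → value 4 (16 * t)) n≤2^r' ⟩
    ∑[ t < 2 ^ r' ] value 4 (16 * toℕ t)  ≤⟨ ∑-blocks≤value r' 4 0 ⟩
    value (r' + 4) 0                      ≡⟨ cong (λ z → value z 0) r≡ ⟨
    value r 0                             ∎
    where
    open ≤-Reasoning

  ∑blocks≤value-root : ∑[ x < n ] value 4 (16 * toℕ x) ≤ value r 0
  ∑blocks≤value-root = [ (λ n≡0 → ≤-trans (≤-reflexive (∑-empty _ n≡0)) z≤n)
                       , (λ (r' , r≡ , n≤2^r') → ∑blocks≤value r' r≡ n≤2^r') ]′ (exponent-split n r big)

  lower-bound : n + numSat φ a₀ ≤ tvalue r gameValue σ
  lower-bound = begin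
    n + numSat φ a₀
      ≡⟨ cong₂ _+_ (trans (sym (*-identityʳ n)) (sym (∑-const n 1))) (sym slotted-total) ⟩
    ∑[ x < n ] 1 + ∑[ x < n ] ∑[ j < 3 ] ∑[ c < m ] 𝟙 (slotted x j c)
      ≡⟨ ∑-distrib-+ {n} _ _ ⟨
    ∑[ x < n ] (1 + ∑[ j < 3 ] ∑[ c < m ] 𝟙 (slotted x j c))
      ≤⟨ ∑-mono-≤ {n} Block.block-value ⟩
    ∑[ x < n ] value 4 (16 * toℕ x)
      ≤⟨ ∑blocks≤value-root ⟩
    value r 0 ∎
    where open ≤-Reasoning


corollary1 : (φ : Formula) → Is23 φ → (ord : AppOrder φ) → ValidOrder φ ord
           → (r : ℕ) → IsLeastExp (nVars φ) r
           → (k : ℕ) → IsOptA φ k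
           → IsOptB r (Construction.gameValue φ ord r) (k + nVars φ)
corollary1 φ is23 ord valid r (big , _) k ((a₀ , a₀-optimal) , optimal) = (σ , ≤-antisym (upper σ) lower) , upper
  where
  n = nVars φ
  m≤3n = clauses≤3n φ is23
  room = room-for-players n (nClauses φ) r m≤3n big
  open LowerBound φ ord valid r room (room-for-dummies n (nClauses φ) r m≤3n big) big a₀ using (σ; lower-bound)
  open ≤-Reasoning

  upper : ∀ σ → tvalue r (Construction.gameValue φ ord r) σ ≤ k + n
  upper σ = begin
    tvalue r (Construction.gameValue φ ord r) σ  ≤⟨ upper-bound ⟩
    n + numSat φ assignment                      ≤⟨ +-monoʳ-≤ n (optimal assignment) ⟩
    n + k                                        ≡⟨ +-comm n k ⟩
    k + n                                        ∎
    where open UpperBound φ ord r room is23 σ using (upper-bound; assignment)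

  lower : k + n ≤ tvalue r (Construction.gameValue φ ord r) σ
  lower = ≤-trans (≤-reflexive (trans (+-comm k n) (cong (n +_) (sym a₀-optimal)))) lower-bound
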